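{- For every model $M$ of $Th(\mathbb{N})$, $(K_M,+,\cdot,<)$ is an ordered field.
   Context: $\mathfrak{L}_{PA}=\{0,1,+,\cdot,<\}$. Let $M\models Th(\mathbb{N})$, $\mathbb{Z}_M=-M\cup M$, $\mathrm{ff}(M)$ its fraction field. An $M$-real is a function $M\to\mathbb{Z}_M\times(M\setminus\{0\})$, $i\mapsto(a_i,b_i)$, with graph definable in $M$ by an $\mathfrak{L}_{PA}$-formula with parameters from $M$, such that the sequence $x_i=a_i/b_i$ is convergent: for every $m\in M^{>0}$ there is $n\in M$ with $m|x_{k_1}-x_{k_2}|<1$ for all $k_1,k_2>n$. $M$-reals $(x_i),(y_i)$ are equivalent if for every $m\in M^{>0}$ there is $n$ with $m|x_k-y_k|<1$ for all $k>n$. $K_M$ is the set of equivalence classes, with addition and multiplication defined termwise ($\frac{a_i}{b_i}+\frac{c_i}{d_i}=\frac{a_id_i+b_ic_i}{b_id_i}$, $\frac{a_i}{b_i}\cdot\frac{c_i}{d_i}=\frac{a_ic_i}{b_id_i}$), and $[x]<[y]$ iff there are $m,k\in M$, $m>0$, with $mx_l+1<my_l$ for all $l>k$. -}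

module Defs where

open import Data.Nat using (ℕ; suc)
open import Data.Fin using (Fin)
open import Data.Vec.Functional using (Vector; []; _∷_; _++_)
open import Data.Product using (Σ; _×_; _,_; proj₁; proj₂)
open import Data.Sum using (_⊎_)
open import Data.Empty using (⊥)
open import Relation.Nullary using (¬_)
open import Relation.Binary.PropositionalEquality using (_≡_)
import Data.Nat as N

infix  6 _≐_ _≺_
infixl 8 _⊕_
infixl 9 _⊗_
infixr 4 _⇒_

data Term (n : ℕ) : Set where
  var  : Fin n → Term n
  𝟘 𝟙  : Term n
  _⊕_  : Term n → Term n → Term n
  _⊗_  : Term n → Term n → Term n

data Formula (n : ℕ) : Set where
  _≐_ _≺_      : Term n → Term n → Formula n
  ⊥f           : Formula n
  _⇒_ _∧f_ _∨f_ : Formula n → Formula n → Formula n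
  ∀f ∃f        : Formula (suc n) → Formula n

Sentence : Set
Sentence = Formula 0

record Structure : Set₁ where
  field
    Carrier : Set
    zero one : Carrier
    _+_ _·_  : Carrier → Carrier → Carrier
    _<_      : Carrier → Carrier → Set

module _ (M : Structure) where
  open Structure M

  eval : ∀ {n} → Term n → Vector Carrier n → Carrier
  eval (var i) e = e i
  eval 𝟘 e = zero
  eval 𝟙 e = one
  eval (t ⊕ s) e = eval t e + eval s e
  eval (t ⊗ s) e = eval t e · eval s e

  Sat : ∀ {n} → Formula n → Vector Carrier n → Set
  Sat (t ≐ s) e = eval t e ≡ eval s e
  Sat (t ≺ s) e = eval t e < eval s e
  Sat ⊥f e = ⊥
  Sat (φ ⇒ ψ) e = Sat φ e → Sat ψ e
  Sat (φ ∧f ψ) e = Sat φ e × Sat ψ e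
  Sat (φ ∨f ψ) e = Sat φ e ⊎ Sat ψ e
  Sat (∀f φ) e = (c : Carrier) → Sat φ (c ∷ e)
  Sat (∃f φ) e = Σ Carrier λ c → Sat φ (c ∷ e)

ℕ-str : Structure
ℕ-str = record
  { Carrier = ℕ ; zero = 0 ; one = 1 ; _+_ = N._+_ ; _·_ = N._*_ ; _<_ = N._<_ }

ModelOfThN : Structure → Set
ModelOfThN M = (φ : Sentence) → Sat ℕ-str φ [] → Sat M φ []

module KM (M : Structure) where
  open Structure M

  -- Z_M = -M ∪ M, an element being coded as a formal difference p - q
  -- with p, q ∈ M.
  ZM : Set
  ZM = Carrier × Carrier

  _<ᶻ_ : ZM → ZM → Set
  (p , q) <ᶻ (r , s) = (p + s) < (r + q)

  _+ᶻ_ : ZM → ZM → ZM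
  (p , q) +ᶻ (r , s) = (p + r) , (q + s)

  _·ᶻ_ : ZM → ZM → ZM
  (p , q) ·ᶻ (r , s) = ((p · r) + (q · s)) , ((p · s) + (q · r))

  ι : Carrier → ZM
  ι c = c , zero

  -- an element a/b of ff(M), a ∈ Z_M, b ∈ M (b ≠ 0 is required separately)
  Frac : Set
  Frac = ZM × Carrier

  num : Frac → ZM
  num = proj₁
  den : Frac → Carrier
  den = proj₂

  _+ꟳ_ : Frac → Frac → Frac
  (a , b) +ꟳ (c , d) = ((a ·ᶻ ι d) +ᶻ (ι b ·ᶻ c)) , (b · d)

  _·ꟳ_ : Frac → Frac → Frac
  (a , b) ·ꟳ (c , d) = (a ·ᶻ c) , (b · d)

  -- the order of ff(M) (denominators are nonzero elements of M, hence > 0):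
  -- a/b < c/d  iff  a·d < c·b
  _<ꟳ_ : Frac → Frac → Set
  (a , b) <ꟳ (c , d) = (a ·ᶻ ι d) <ᶻ (c ·ᶻ ι b)

  scale : Carrier → Frac → Frac
  scale m (a , b) = (ι m ·ᶻ a) , b

  1ꟳ : Frac
  1ꟳ = ι one , one

  0ꟳ : Frac
  0ꟳ = ι zero , one

  -- m · |x - y| < 1, i.e.  m(x - y) < 1  and  m(y - x) < 1, written as
  -- m·x < 1 + m·y  and  m·y < 1 + m·x
  Close : Carrier → Frac → Frac → Set
  Close m x y = (scale m x <ꟳ (1ꟳ +ꟳ scale m y))
              × (scale m y <ꟳ (1ꟳ +ꟳ scale m x))

  Seq : Set
  Seq = Carrier → Frac

  -- the graph {(i, a_i, b_i)} is L_PA-definable with parameters from M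
  -- (a_i coded by its two components p_i, q_i)
  DefinableGraph : Seq → Set
  DefinableGraph x =
    Σ ℕ λ k → Σ (Vector Carrier k) λ params → Σ (Formula (4 N.+ k)) λ φ →
      (i p q b : Carrier) →
        (Sat M φ ((i ∷ p ∷ q ∷ b ∷ []) ++ params) → x i ≡ ((p , q) , b))
        × (x i ≡ ((p , q) , b) → Sat M φ ((i ∷ p ∷ q ∷ b ∷ []) ++ params))

  Convergent : Seq → Set
  Convergent x = (m : Carrier) → zero < m → Σ Carrier λ n →
    (k₁ k₂ : Carrier) → n < k₁ → n < k₂ → Close m (x k₁) (x k₂)

  record IsMReal (x : Seq) : Set where
    field
      den≢0      : (i : Carrier) → ¬ (den (x i) ≡ zero)
      definable  : DefinableGraph x
      convergent : Convergent x

  _≈_ : Seq → Seq → Set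
  x ≈ y = (m : Carrier) → zero < m → Σ Carrier λ n →
    (k : Carrier) → n < k → Close m (x k) (y k)

  _⊞_ : Seq → Seq → Seq
  (x ⊞ y) i = x i +ꟳ y i

  _⊠_ : Seq → Seq → Seq
  (x ⊠ y) i = x i ·ꟳ y i

  0ˢ : Seq
  0ˢ i = 0ꟳ

  1ˢ : Seq
  1ˢ i = 1ꟳ

  _≺ˢ_ : Seq → Seq → Set
  x ≺ˢ y = Σ Carrier λ m → Σ Carrier λ k → (zero < m) ×
    ((l : Carrier) → k < l → (scale m (x l) +ꟳ 1ꟳ) <ꟳ scale m (y l))

  record IsOrderedField : Set where
    field
      0-real : IsMReal 0ˢ
      1-real : IsMReal 1ˢ
      +-real : ∀ {x y} → IsMReal x → IsMReal y → IsMReal (x ⊞ y)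
      ·-real : ∀ {x y} → IsMReal x → IsMReal y → IsMReal (x ⊠ y)
      ≈-refl  : ∀ {x} → IsMReal x → x ≈ x
      ≈-sym   : ∀ {x y} → IsMReal x → IsMReal y → x ≈ y → y ≈ x
      ≈-trans : ∀ {x y z} → IsMReal x → IsMReal y → IsMReal z →
                x ≈ y → y ≈ z → x ≈ z
      +-cong : ∀ {x x' y y'} → IsMReal x → IsMReal x' → IsMReal y → IsMReal y' →
               x ≈ x' → y ≈ y' → (x ⊞ y) ≈ (x' ⊞ y')
      ·-cong : ∀ {x x' y y'} → IsMReal x → IsMReal x' → IsMReal y → IsMReal y' →
               x ≈ x' → y ≈ y' → (x ⊠ y) ≈ (x' ⊠ y')
      <-resp : ∀ {x x' y y'} → IsMReal x → IsMReal x' → IsMReal y → IsMReal y' →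
               x ≈ x' → y ≈ y' → x ≺ˢ y → x' ≺ˢ y'
      +-assoc : ∀ {x y z} → IsMReal x → IsMReal y → IsMReal z →
                ((x ⊞ y) ⊞ z) ≈ (x ⊞ (y ⊞ z))
      +-comm  : ∀ {x y} → IsMReal x → IsMReal y → (x ⊞ y) ≈ (y ⊞ x)
      +-idʳ   : ∀ {x} → IsMReal x → (x ⊞ 0ˢ) ≈ x
      +-inv   : ∀ {x} → IsMReal x → Σ Seq λ y → IsMReal y × ((x ⊞ y) ≈ 0ˢ)
      ·-assoc : ∀ {x y z} → IsMReal x → IsMReal y → IsMReal z →
                ((x ⊠ y) ⊠ z) ≈ (x ⊠ (y ⊠ z))
      ·-comm  : ∀ {x y} → IsMReal x → IsMReal y → (x ⊠ y) ≈ (y ⊠ x)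
      ·-idʳ   : ∀ {x} → IsMReal x → (x ⊠ 1ˢ) ≈ x
      ·-inv   : ∀ {x} → IsMReal x → ¬ (x ≈ 0ˢ) →
                Σ Seq λ y → IsMReal y × ((x ⊠ y) ≈ 1ˢ)
      distrib : ∀ {x y z} → IsMReal x → IsMReal y → IsMReal z →
                (x ⊠ (y ⊞ z)) ≈ ((x ⊠ y) ⊞ (x ⊠ z))
      0≉1     : ¬ (0ˢ ≈ 1ˢ)
      <-irrefl : ∀ {x} → IsMReal x → ¬ (x ≺ˢ x)
      <-trans  : ∀ {x y z} → IsMReal x → IsMReal y → IsMReal z →
                 x ≺ˢ y → y ≺ˢ z → x ≺ˢ z
      <-trichotomy : ∀ {x y} → IsMReal x → IsMReal y →
                     (x ≺ˢ y) ⊎ (x ≈ y) ⊎ (y ≺ˢ x)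
      +-mono-< : ∀ {x y z} → IsMReal x → IsMReal y → IsMReal z →
                 x ≺ˢ y → (x ⊞ z) ≺ˢ (y ⊞ z)
      ·-pos    : ∀ {x y} → IsMReal x → IsMReal y →
                 0ˢ ≺ˢ x → 0ˢ ≺ˢ y → 0ˢ ≺ˢ (x ⊠ y)

-- Each law of an ordered field for K_M reduces, term by term, to an estimate about fractions that is
-- uniform in its parameters; e.g. if x, x' and y, y' are 1/(2m)-close then x + y and x' + y' are
-- 1/m-close. Such an estimate is one L_PA-formula in the components of the fractions; it holds in ℕ,
-- where it is proved through ℚ, and hence in every M ⊨ Th(ℕ). For products the required precision is
-- scaled by a bound on the two sequences, and for inverses by a bound on the reciprocals. An M-real not
-- equivalent to 0 has, by excluded middle, a term far from 0 beyond which it varies little, so all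
-- later terms stay away from 0; the termwise inverse in ff(M), whose graph is definable, is then again
-- an M-real. In the same way two inequivalent M-reals are eventually separated, giving trichotomy.

module Submission where

open import Defs
open import Level using (0ℓ)
open import Axiom.ExcludedMiddle using (ExcludedMiddle)
open import Axiom.DoubleNegationElimination using (em⇒dne)
open import Data.Empty using (⊥; ⊥-elim)
open import Data.Unit using (⊤)
open import Data.Product using (Σ; _×_; _,_; proj₁; proj₂)
open import Data.Sum using (_⊎_; inj₁; inj₂; [_,_]′)
open import Data.Nat as ℕ using (ℕ; zero; suc)
import Data.Nat.Properties as ℕₚ
open import Data.Integer as ℤ using (ℤ; +_; -[1+_])
import Data.Integer.Properties as ℤₚ
open import Data.Integer.Tactic.RingSolver using (solve-∀)
open import Data.Rational.Unnormalised as ℚ using (ℚᵘ; mkℚᵘ; _≃_; *≡*; *<*; *≤*)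
import Data.Rational.Unnormalised.Properties as ℚₚ
open import Data.Rational.Unnormalised.Solver using (module +-*-Solver)
open import Data.Fin using (Fin; zero; suc; #_; _↑ˡ_; _↑ʳ_)
open import Data.Fin.Properties using (splitAt-↑ˡ; splitAt-↑ʳ)
open import Data.Vec.Functional using (Vector; []; _∷_; _++_)
open import Function using (_∘_; _⇔_; mk⇔; Equivalence)
open import Relation.Nullary using (¬_; Dec; yes; no)
open import Relation.Binary using (Tri; tri<; tri≈; tri>)
open import Relation.Binary.PropositionalEquality
  using (_≡_; refl; sym; trans; cong; cong₂; subst; subst₂)

module FirstOrder where
  module _ (S : Structure) where
    open Structure S using (Carrier; _+_; _·_; _<_)

    eval-cong : ∀ {n} (t : Term n) {e e' : Vector Carrier n} →
                (∀ i → e i ≡ e' i) → eval S t e ≡ eval S t e'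
    eval-cong (var i) h = h i
    eval-cong 𝟘       h = refl
    eval-cong 𝟙       h = refl
    eval-cong (t ⊕ s) h = cong₂ _+_ (eval-cong t h) (eval-cong s h)
    eval-cong (t ⊗ s) h = cong₂ _·_ (eval-cong t h) (eval-cong s h)

    ∷-cong : ∀ {n} {e e' : Vector Carrier n} (c : Carrier) →
             (∀ i → e i ≡ e' i) → ∀ i → (c ∷ e) i ≡ (c ∷ e') i
    ∷-cong c h zero    = refl
    ∷-cong c h (suc i) = h i

    Sat-cong : ∀ {n} (φ : Formula n) {e e' : Vector Carrier n} →
               (∀ i → e i ≡ e' i) → Sat S φ e → Sat S φ e'
    Sat-cong (t ≐ s)  h p        = trans (sym (eval-cong t h)) (trans p (eval-cong s h))
    Sat-cong (t ≺ s)  h p        = subst₂ _<_ (eval-cong t h) (eval-cong s h) p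
    Sat-cong ⊥f       h p        = p
    Sat-cong (φ ⇒ ψ)  h p        = λ a → Sat-cong ψ h (p (Sat-cong φ (λ i → sym (h i)) a))
    Sat-cong (φ ∧f ψ) h (a , b)  = Sat-cong φ h a , Sat-cong ψ h b
    Sat-cong (φ ∨f ψ) h (inj₁ a) = inj₁ (Sat-cong φ h a)
    Sat-cong (φ ∨f ψ) h (inj₂ b) = inj₂ (Sat-cong ψ h b)
    Sat-cong (∀f φ)   h p        = λ c → Sat-cong φ (∷-cong c h) (p c)
    Sat-cong (∃f φ)   h (c , p)  = c , Sat-cong φ (∷-cong c h) p

  universalClosure : ∀ n → Formula n → Sentence
  universalClosure zero    φ = φ
  universalClosure (suc n) φ = universalClosure n (∀f φ)

  module _ (S : Structure) where

    Sat-universalClosure⁺ : ∀ n (φ : Formula n) → (∀ e → Sat S φ e) →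
                            Sat S (universalClosure n φ) []
    Sat-universalClosure⁺ zero    φ h = h []
    Sat-universalClosure⁺ (suc n) φ h =
      Sat-universalClosure⁺ n (∀f φ) (λ e c → h (c ∷ e))

    Sat-universalClosure⁻ : ∀ n (φ : Formula n) → Sat S (universalClosure n φ) [] →
                            ∀ e → Sat S φ e
    Sat-universalClosure⁻ zero    φ h e = Sat-cong S φ (λ ()) h
    Sat-universalClosure⁻ (suc n) φ h e =
      Sat-cong S φ head∷tail (Sat-universalClosure⁻ n (∀f φ) h (λ i → e (suc i)) (e zero))
      where
      head∷tail : ∀ i → (e zero ∷ (λ i → e (suc i))) i ≡ e i
      head∷tail zero    = refl
      head∷tail (suc i) = refl

  transfer : ∀ {M} → ModelOfThN M → ∀ {n} (φ : Formula n) →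
             (∀ e → Sat ℕ-str φ e) → ∀ e → Sat M φ e
  transfer {M} M⊨Th {n} φ h =
    Sat-universalClosure⁻ M n φ (M⊨Th (universalClosure n φ) (Sat-universalClosure⁺ ℕ-str n φ h))

  lift : ∀ {n m} → (Fin n → Fin m) → Fin (suc n) → Fin (suc m)
  lift ρ zero    = zero
  lift ρ (suc i) = suc (ρ i)

  renameTerm : ∀ {n m} → (Fin n → Fin m) → Term n → Term m
  renameTerm ρ (var i) = var (ρ i)
  renameTerm ρ 𝟘       = 𝟘
  renameTerm ρ 𝟙       = 𝟙
  renameTerm ρ (t ⊕ s) = renameTerm ρ t ⊕ renameTerm ρ s
  renameTerm ρ (t ⊗ s) = renameTerm ρ t ⊗ renameTerm ρ s

  rename : ∀ {n m} → (Fin n → Fin m) → Formula n → Formula m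
  rename ρ (t ≐ s)  = renameTerm ρ t ≐ renameTerm ρ s
  rename ρ (t ≺ s)  = renameTerm ρ t ≺ renameTerm ρ s
  rename ρ ⊥f       = ⊥f
  rename ρ (φ ⇒ ψ)  = rename ρ φ ⇒ rename ρ ψ
  rename ρ (φ ∧f ψ) = rename ρ φ ∧f rename ρ ψ
  rename ρ (φ ∨f ψ) = rename ρ φ ∨f rename ρ ψ
  rename ρ (∀f φ)   = ∀f (rename (lift ρ) φ)
  rename ρ (∃f φ)   = ∃f (rename (lift ρ) φ)

  module _ (S : Structure) where
    open Structure S using (Carrier; _+_; _·_; _<_)

    eval-rename : ∀ {n m} (ρ : Fin n → Fin m) (t : Term n)
                  {e : Vector Carrier m} {e' : Vector Carrier n} →
                  (∀ i → e (ρ i) ≡ e' i) → eval S (renameTerm ρ t) e ≡ eval S t e'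
    eval-rename ρ (var i) h = h i
    eval-rename ρ 𝟘       h = refl
    eval-rename ρ 𝟙       h = refl
    eval-rename ρ (t ⊕ s) h = cong₂ _+_ (eval-rename ρ t h) (eval-rename ρ s h)
    eval-rename ρ (t ⊗ s) h = cong₂ _·_ (eval-rename ρ t h) (eval-rename ρ s h)

    lift-∷ : ∀ {n m} (ρ : Fin n → Fin m) {e : Vector Carrier m} {e' : Vector Carrier n} →
             (∀ i → e (ρ i) ≡ e' i) → (c : Carrier) → ∀ i → (c ∷ e) (lift ρ i) ≡ (c ∷ e') i
    lift-∷ ρ h c zero    = refl
    lift-∷ ρ h c (suc i) = h i

    Sat-rename : ∀ {n m} (ρ : Fin n → Fin m) (φ : Formula n)
                 {e : Vector Carrier m} {e' : Vector Carrier n} →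
                 (∀ i → e (ρ i) ≡ e' i) → Sat S (rename ρ φ) e ⇔ Sat S φ e'
    Sat-rename ρ (t ≐ s) h = mk⇔
      (λ p → trans (sym (eval-rename ρ t h)) (trans p (eval-rename ρ s h)))
      (λ p → trans (eval-rename ρ t h) (trans p (sym (eval-rename ρ s h))))
    Sat-rename ρ (t ≺ s) h = mk⇔
      (subst₂ _<_ (eval-rename ρ t h) (eval-rename ρ s h))
      (subst₂ _<_ (sym (eval-rename ρ t h)) (sym (eval-rename ρ s h)))
    Sat-rename ρ ⊥f h = mk⇔ (λ p → p) (λ p → p)
    Sat-rename ρ (φ ⇒ ψ) h = mk⇔
      (λ p a → Equivalence.to (Sat-rename ρ ψ h) (p (Equivalence.from (Sat-rename ρ φ h) a)))
      (λ p a → Equivalence.from (Sat-rename ρ ψ h) (p (Equivalence.to (Sat-rename ρ φ h) a)))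
    Sat-rename ρ (φ ∧f ψ) h = mk⇔
      (λ (a , b) → Equivalence.to (Sat-rename ρ φ h) a , Equivalence.to (Sat-rename ρ ψ h) b)
      (λ (a , b) → Equivalence.from (Sat-rename ρ φ h) a , Equivalence.from (Sat-rename ρ ψ h) b)
    Sat-rename ρ (φ ∨f ψ) h = mk⇔
      (λ { (inj₁ a) → inj₁ (Equivalence.to (Sat-rename ρ φ h) a)
         ; (inj₂ b) → inj₂ (Equivalence.to (Sat-rename ρ ψ h) b) })
      (λ { (inj₁ a) → inj₁ (Equivalence.from (Sat-rename ρ φ h) a)
         ; (inj₂ b) → inj₂ (Equivalence.from (Sat-rename ρ ψ h) b) })
    Sat-rename ρ (∀f φ) h = mk⇔
      (λ p c → Equivalence.to (Sat-rename (lift ρ) φ (lift-∷ ρ h c)) (p c))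
      (λ p c → Equivalence.from (Sat-rename (lift ρ) φ (lift-∷ ρ h c)) (p c))
    Sat-rename ρ (∃f φ) h = mk⇔
      (λ (c , p) → c , Equivalence.to (Sat-rename (lift ρ) φ (lift-∷ ρ h c)) p)
      (λ (c , p) → c , Equivalence.from (Sat-rename (lift ρ) φ (lift-∷ ρ h c)) p)

open FirstOrder

module FracOps (S : Structure) where
  open Structure S using (Carrier; _+_; _·_; _<_) renaming (zero to 0ᴹ; one to 1ᴹ)
  open KM S

  fourfold : Carrier → Carrier
  fourfold m = (m + m) + (m + m)

  NonzeroDen : Frac → Set
  NonzeroDen x = ¬ den x ≡ 0ᴹ

  neg : Frac → Frac
  neg ((p , q) , b) = (q , p) , b

  Less : Carrier → Frac → Frac → Set
  Less m x y = (scale m x +ꟳ 1ꟳ) <ꟳ scale m y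

  Apart : Carrier → Frac → Set
  Apart c x = (1ꟳ <ꟳ scale c x) ⊎ (1ꟳ <ꟳ scale c (neg x))

  -- The graph of inversion on ff(M), with 0⁻¹ = 0: the inverse of (p - q)/b has denominator |p - q|.
  IsInverse : Frac → Frac → Set
  IsInverse ((p , q) , b) ((p' , q') , b') =
      (p ≡ q × p' ≡ 0ᴹ × q' ≡ 0ᴹ × b' ≡ 1ᴹ)
    ⊎ (q < p × p' ≡ b × q' ≡ 0ᴹ × q + b' ≡ p)
    ⊎ (p < q × p' ≡ 0ᴹ × q' ≡ b × p + b' ≡ q)

  -- An upper bound for |x| + 1, as denominators are at least 1.
  height : Frac → Carrier
  height ((p , q) , b) = (p + q) + 1ᴹ

  -- The precision needed on both factors for x y to be m-close to x' y', when x and y' are 1-close to x₀ and y₀.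
  productModulus : Carrier → Frac → Frac → Carrier
  productModulus m x₀ y₀ = (m · H) + (m · H)
    where
    H = height x₀ + height y₀

module FractionFormulas where
  -- Terms form an L_PA-structure (with a dummy order), so KM and FracOps instantiated at it build terms.
  -- The formulas below are arranged so that their satisfaction in any S is definitionally the matching
  -- relation of KM S or FracOps S on the evaluated arguments; this is what lets transfer act on them.
  TermStructure : ℕ → Structure
  TermStructure n = record
    { Carrier = Term n ; zero = 𝟘 ; one = 𝟙 ; _+_ = _⊕_ ; _·_ = _⊗_ ; _<_ = λ _ _ → ⊤ }

  module Tm (n : ℕ) where
    open KM (TermStructure n) public
    open FracOps (TermStructure n) public using (neg; height; fourfold; productModulus)

  FracTerm : ℕ → Set
  FracTerm = Tm.Frac

  module _ {n : ℕ} where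
    private module T = Tm n

    infixl 6 _+ꟳᵗ_
    infixl 7 _·ꟳᵗ_

    _+ꟳᵗ_ _·ꟳᵗ_ : FracTerm n → FracTerm n → FracTerm n
    _+ꟳᵗ_ = T._+ꟳ_
    _·ꟳᵗ_ = T._·ꟳ_

    0ꟳᵗ 1ꟳᵗ : FracTerm n
    0ꟳᵗ = T.0ꟳ
    1ꟳᵗ = T.1ꟳ

    scaleᵗ : Term n → FracTerm n → FracTerm n
    scaleᵗ = T.scale

    negᵗ : FracTerm n → FracTerm n
    negᵗ = T.neg

    heightᵗ : FracTerm n → Term n
    heightᵗ = T.height

    fourfoldᵗ : Term n → Term n
    fourfoldᵗ = T.fourfold

    productModulusᵗ : Term n → FracTerm n → FracTerm n → Term n
    productModulusᵗ = T.productModulus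

  fracVar : ∀ {n} → Fin n → Fin n → Fin n → FracTerm n
  fracVar i j k = (var i , var j) , var k

  module _ {n : ℕ} where
    open Tm n

    _<ᶻᶠ_ : ZM → ZM → Formula n
    (p , q) <ᶻᶠ (r , s) = (p ⊕ s) ≺ (r ⊕ q)

    _<ꟳᶠ_ : Frac → Frac → Formula n
    (a , b) <ꟳᶠ (c , d) = (a ·ᶻ ι d) <ᶻᶠ (c ·ᶻ ι b)

    _≐ꟳ_ : Frac → Frac → Formula n
    ((p , q) , b) ≐ꟳ ((p' , q') , b') = (p ≐ p') ∧f ((q ≐ q') ∧f (b ≐ b'))

    Closeᶠ : Term n → Frac → Frac → Formula n
    Closeᶠ m x y = (scale m x <ꟳᶠ (1ꟳ +ꟳ scale m y)) ∧f (scale m y <ꟳᶠ (1ꟳ +ꟳ scale m x))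

    NonzeroDenᶠ : Frac → Formula n
    NonzeroDenᶠ x = (den x ≐ 𝟘) ⇒ ⊥f

    Lessᶠ : Term n → Frac → Frac → Formula n
    Lessᶠ m x y = (scale m x +ꟳ 1ꟳ) <ꟳᶠ scale m y

    Apartᶠ : Term n → Frac → Formula n
    Apartᶠ c x = (1ꟳ <ꟳᶠ scale c x) ∨f (1ꟳ <ꟳᶠ scale c (neg x))

    IsInverseᶠ : Frac → Frac → Formula n
    IsInverseᶠ ((p , q) , b) ((p' , q') , b') =
          ((p ≐ q) ∧f ((p' ≐ 𝟘) ∧f ((q' ≐ 𝟘) ∧f (b' ≐ 𝟙))))
      ∨f (((q ≺ p) ∧f ((p' ≐ b) ∧f ((q' ≐ 𝟘) ∧f ((q ⊕ b') ≐ p))))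
      ∨f  ((p ≺ q) ∧f ((p' ≐ 𝟘) ∧f ((q' ≐ b) ∧f ((p ⊕ b') ≐ q)))))

  evalꟳ : ∀ S {n} → FracTerm n → Vector (Structure.Carrier S) n → KM.Frac S
  evalꟳ S ((p , q) , b) e = (eval S p e , eval S q e) , eval S b e

open FractionFormulas

module RationalEstimates where
  open ℚ using (_+_; _*_; _-_; -_; _<_; _≤_; ∣_∣; 0ℚᵘ; 1ℚᵘ)
  open +-*-Solver

  Closeℚ : ℚᵘ → ℚᵘ → ℚᵘ → Set
  Closeℚ m X Y = (m * X < 1ℚᵘ + m * Y) × (m * Y < 1ℚᵘ + m * X)

  Lessℚ : ℚᵘ → ℚᵘ → ℚᵘ → Set
  Lessℚ m X Y = m * X + 1ℚᵘ < m * Y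

  Apartℚ : ℚᵘ → ℚᵘ → Set
  Apartℚ c X = (1ℚᵘ < c * X) ⊎ (1ℚᵘ < c * (- X))

  4× : ℚᵘ → ℚᵘ
  4× m = (m + m) + (m + m)

  <-resp₂-≃ : ∀ {a a' b b'} → a ≃ a' → b ≃ b' → a < b → a' < b'
  <-resp₂-≃ a≃a' b≃b' a<b = ℚₚ.<-respʳ-≃ b≃b' (ℚₚ.<-respˡ-≃ a≃a' a<b)

  p<q⇒0<q-p : ∀ {p q} → p < q → 0ℚᵘ < q - p
  p<q⇒0<q-p {p} h = <-resp₂-≃ (ℚₚ.+-inverseʳ p) ℚₚ.≃-refl (ℚₚ.+-monoˡ-< (- p) h)

  ≮⇒0≤p-q : ∀ {p q} → ¬ p < q → 0ℚᵘ ≤ p - q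
  ≮⇒0≤p-q h = ℚₚ.p≤q⇒0≤q-p (ℚₚ.≮⇒≥ h)

  -- Every strict inequality below is proved by exhibiting its gap as a positive combination.
  <-by-gap : ∀ {p q g} → g ≃ q - p → 0ℚᵘ < g → p < q
  <-by-gap {p} {q} g≃q-p 0<g =
    <-resp₂-≃ (ℚₚ.+-identityˡ p) (q-p+p p q) (ℚₚ.+-monoˡ-< p (<-resp₂-≃ ℚₚ.≃-refl g≃q-p 0<g))
    where
    q-p+p : ∀ p q → (q - p) + p ≃ q
    q-p+p = solve 2 (λ p q → (q :- p) :+ p := q) ℚₚ.≃-refl

  +-pos : ∀ {u v} → 0ℚᵘ < u → 0ℚᵘ < v → 0ℚᵘ < u + v
  +-pos h₁ h₂ = ℚₚ.<-respˡ-≃ (ℚₚ.+-identityˡ 0ℚᵘ) (ℚₚ.+-mono-< h₁ h₂)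

  +-nonNeg-pos : ∀ {u v} → 0ℚᵘ ≤ u → 0ℚᵘ < v → 0ℚᵘ < u + v
  +-nonNeg-pos h₁ h₂ = ℚₚ.<-respˡ-≃ (ℚₚ.+-identityˡ 0ℚᵘ) (ℚₚ.+-mono-≤-< h₁ h₂)

  +-nonNeg : ∀ {u v} → 0ℚᵘ ≤ u → 0ℚᵘ ≤ v → 0ℚᵘ ≤ u + v
  +-nonNeg h₁ h₂ = ℚₚ.≤-respˡ-≃ (ℚₚ.+-identityˡ 0ℚᵘ) (ℚₚ.+-mono-≤ h₁ h₂)

  *-pos : ∀ {a b} → 0ℚᵘ < a → 0ℚᵘ < b → 0ℚᵘ < a * b
  *-pos {a} ha hb = <-resp₂-≃ (ℚₚ.*-zeroʳ a) ℚₚ.≃-refl (ℚₚ.*-monoʳ-<-pos a {{ℚ.positive ha}} hb)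

  *-nonNeg : ∀ {a b} → 0ℚᵘ ≤ a → 0ℚᵘ ≤ b → 0ℚᵘ ≤ a * b
  *-nonNeg {a} {b} ha hb =
    ℚₚ.nonNegative⁻¹ (a * b) {{ℚₚ.nonNeg*nonNeg⇒nonNeg a {{ℚ.nonNegative ha}} b {{ℚ.nonNegative hb}}}}

  0<p+p⇒0<p : ∀ {p} → 0ℚᵘ < p + p → 0ℚᵘ < p
  0<p+p⇒0<p {p} h with 0ℚᵘ ℚₚ.<? p
  ... | yes 0<p = 0<p
  ... | no 0≮p = ⊥-elim (ℚₚ.<-irrefl ℚₚ.≃-refl (ℚₚ.<-≤-trans h p+p≤0))
    where
    p≤0 = ℚₚ.≮⇒≥ 0≮p
    p+p≤0 : p + p ≤ 0ℚᵘ
    p+p≤0 = ℚₚ.≤-respʳ-≃ (ℚₚ.+-identityˡ 0ℚᵘ) (ℚₚ.+-mono-≤ p≤0 p≤0)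

  0<1 : 0ℚᵘ < 1ℚᵘ
  0<1 = *<* (ℤ.+<+ (ℕ.s≤s ℕ.z≤n))

  Closeℚ-cong : ∀ {m m' X X' Y Y'} → m ≃ m' → X ≃ X' → Y ≃ Y' → Closeℚ m X Y → Closeℚ m' X' Y'
  Closeℚ-cong m≃ X≃ Y≃ (h₁ , h₂) =
    <-resp₂-≃ (ℚₚ.*-cong m≃ X≃) (ℚₚ.+-congʳ 1ℚᵘ (ℚₚ.*-cong m≃ Y≃)) h₁ ,
    <-resp₂-≃ (ℚₚ.*-cong m≃ Y≃) (ℚₚ.+-congʳ 1ℚᵘ (ℚₚ.*-cong m≃ X≃)) h₂

  Apartℚ-cong : ∀ {c c' X} → c ≃ c' → Apartℚ c X → Apartℚ c' X
  Apartℚ-cong {X = X} c≃c' (inj₁ h) = inj₁ (<-resp₂-≃ ℚₚ.≃-refl (ℚₚ.*-congʳ {X} c≃c') h)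
  Apartℚ-cong {X = X} c≃c' (inj₂ h) = inj₂ (<-resp₂-≃ ℚₚ.≃-refl (ℚₚ.*-congʳ { - X} c≃c') h)

  Lessℚ-cong : ∀ {m m' X X' Y Y'} → m ≃ m' → X ≃ X' → Y ≃ Y' → Lessℚ m X Y → Lessℚ m' X' Y'
  Lessℚ-cong m≃ X≃ Y≃ = <-resp₂-≃ (ℚₚ.+-congˡ 1ℚᵘ (ℚₚ.*-cong m≃ X≃)) (ℚₚ.*-cong m≃ Y≃)

  Closeℚ-refl : ∀ m X → Closeℚ m X X
  Closeℚ-refl m X = mX<1+mX , mX<1+mX
    where
    gap : ∀ m X → 1ℚᵘ ≃ (1ℚᵘ + m * X) - m * X
    gap = solve 2 (λ m X → con 1ℚᵘ := (con 1ℚᵘ :+ m :* X) :- m :* X) ℚₚ.≃-refl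
    mX<1+mX = <-by-gap (gap m X) 0<1

  ≃⇒Closeℚ : ∀ m {X Y} → X ≃ Y → Closeℚ m X Y
  ≃⇒Closeℚ m {X} {Y} X≃Y = Closeℚ-cong {m} {m} {X} {X} {X} {Y} ℚₚ.≃-refl ℚₚ.≃-refl X≃Y (Closeℚ-refl m X)

  Closeℚ-trans : ∀ m X Y Z → Closeℚ (m + m) X Y → Closeℚ (m + m) Y Z → Closeℚ m X Z
  Closeℚ-trans m X Y Z (h₁ , h₂) (h₃ , h₄) = half-trans X Y Z h₁ h₃ , half-trans Z Y X h₄ h₂
    where
    gaps : ∀ m X Y Z → ((1ℚᵘ + (m + m) * Y) - (m + m) * X) + ((1ℚᵘ + (m + m) * Z) - (m + m) * Y)
                     ≃ ((1ℚᵘ + m * Z) - m * X) + ((1ℚᵘ + m * Z) - m * X)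
    gaps = solve 4 (λ m X Y Z →
             ((con 1ℚᵘ :+ (m :+ m) :* Y) :- (m :+ m) :* X) :+ ((con 1ℚᵘ :+ (m :+ m) :* Z) :- (m :+ m) :* Y)
             := ((con 1ℚᵘ :+ m :* Z) :- m :* X) :+ ((con 1ℚᵘ :+ m :* Z) :- m :* X)) ℚₚ.≃-refl
    half-trans : ∀ X Y Z → (m + m) * X < 1ℚᵘ + (m + m) * Y → (m + m) * Y < 1ℚᵘ + (m + m) * Z →
                 m * X < 1ℚᵘ + m * Z
    half-trans X Y Z h h' = <-by-gap ℚₚ.≃-refl
      (0<p+p⇒0<p (<-resp₂-≃ ℚₚ.≃-refl (gaps m X Y Z) (+-pos (p<q⇒0<q-p h) (p<q⇒0<q-p h'))))

  Closeℚ-+ : ∀ m X X' Y Y' → Closeℚ (m + m) X X' → Closeℚ (m + m) Y Y' → Closeℚ m (X + Y) (X' + Y')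
  Closeℚ-+ m X X' Y Y' (h₁ , h₂) (h₃ , h₄) = half-+ X X' Y Y' h₁ h₃ , half-+ X' X Y' Y h₂ h₄
    where
    gaps : ∀ m X X' Y Y' → ((1ℚᵘ + (m + m) * X') - (m + m) * X) + ((1ℚᵘ + (m + m) * Y') - (m + m) * Y)
                         ≃ ((1ℚᵘ + m * (X' + Y')) - m * (X + Y)) + ((1ℚᵘ + m * (X' + Y')) - m * (X + Y))
    gaps = solve 5 (λ m X X' Y Y' →
             ((con 1ℚᵘ :+ (m :+ m) :* X') :- (m :+ m) :* X) :+ ((con 1ℚᵘ :+ (m :+ m) :* Y') :- (m :+ m) :* Y)
             := ((con 1ℚᵘ :+ m :* (X' :+ Y')) :- m :* (X :+ Y)) :+ ((con 1ℚᵘ :+ m :* (X' :+ Y')) :- m :* (X :+ Y)))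
             ℚₚ.≃-refl
    half-+ : ∀ X X' Y Y' → (m + m) * X < 1ℚᵘ + (m + m) * X' → (m + m) * Y < 1ℚᵘ + (m + m) * Y' →
             m * (X + Y) < 1ℚᵘ + m * (X' + Y')
    half-+ X X' Y Y' h h' = <-by-gap ℚₚ.≃-refl
      (0<p+p⇒0<p (<-resp₂-≃ ℚₚ.≃-refl (gaps m X X' Y Y') (+-pos (p<q⇒0<q-p h) (p<q⇒0<q-p h'))))

  Closeℚ-neg : ∀ m X Y → Closeℚ m X Y → Closeℚ m (- X) (- Y)
  Closeℚ-neg m X Y (h₁ , h₂) = half-neg X Y h₂ , half-neg Y X h₁
    where
    gap : ∀ m X Y → (1ℚᵘ + m * X) - m * Y ≃ (1ℚᵘ + m * (- Y)) - m * (- X)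
    gap = solve 3 (λ m X Y → (con 1ℚᵘ :+ m :* X) :- m :* Y := (con 1ℚᵘ :+ m :* (:- Y)) :- m :* (:- X))
            ℚₚ.≃-refl
    half-neg : ∀ X Y → m * Y < 1ℚᵘ + m * X → m * (- X) < 1ℚᵘ + m * (- Y)
    half-neg X Y h = <-by-gap (gap m X Y) (p<q⇒0<q-p h)

  p<p+1 : ∀ p → p < p + 1ℚᵘ
  p<p+1 p = <-by-gap (gap p) 0<1
    where
    gap : ∀ p → 1ℚᵘ ≃ (p + 1ℚᵘ) - p
    gap = solve 1 (λ p → con 1ℚᵘ := (p :+ con 1ℚᵘ) :- p) ℚₚ.≃-refl

  Lessℚ-irrefl : ∀ m X → ¬ Lessℚ m X X
  Lessℚ-irrefl m X = ℚₚ.<-asym (p<p+1 (m * X))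

  Lessℚ-+ʳ : ∀ m X Y Z → Lessℚ m X Y → Lessℚ m (X + Z) (Y + Z)
  Lessℚ-+ʳ m X Y Z h = <-by-gap (gap m X Y Z) (p<q⇒0<q-p h)
    where
    gap : ∀ m X Y Z → m * Y - (m * X + 1ℚᵘ) ≃ m * (Y + Z) - (m * (X + Z) + 1ℚᵘ)
    gap = solve 4 (λ m X Y Z → m :* Y :- (m :* X :+ con 1ℚᵘ) := m :* (Y :+ Z) :- (m :* (X :+ Z) :+ con 1ℚᵘ))
            ℚₚ.≃-refl

  Lessℚ-trans : ∀ m₁ m₂ X Y Z → 0ℚᵘ ≤ m₁ → 0ℚᵘ ≤ m₂ → Lessℚ m₁ X Y → Lessℚ m₂ Y Z → Lessℚ m₁ X Z
  Lessℚ-trans m₁ m₂ X Y Z 0≤m₁ 0≤m₂ h₁ h₂ = ℚₚ.<-≤-trans h₁ (ℚₚ.*-monoʳ-≤-nonNeg m₁ {{ℚ.nonNegative 0≤m₁}} (ℚₚ.<⇒≤ Y<Z))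
    where
    Y<Z : Y < Z
    Y<Z = ℚₚ.*-cancelˡ-<-nonNeg m₂ {{ℚ.nonNegative 0≤m₂}} (ℚₚ.<-trans (p<p+1 (m₂ * Y)) h₂)

  Lessℚ-resp-Closeℚ : ∀ m X Y X' Y' → Lessℚ m X Y → Closeℚ (4× m) X X' → Closeℚ (4× m) Y Y' →
                      Lessℚ (4× m) X' Y'
  Lessℚ-resp-Closeℚ m X Y X' Y' h (_ , X'≈X) (Y≈Y' , _) =
    <-by-gap (gaps m X Y X' Y') (+-pos (+-pos (+-pos (+-pos g g) (+-pos g g)) (p<q⇒0<q-p X'≈X))
                                        (+-pos (p<q⇒0<q-p Y≈Y') 0<1))
    where
    g = p<q⇒0<q-p h
    gaps : ∀ m X Y X' Y' →
           ((((m * Y - (m * X + 1ℚᵘ)) + (m * Y - (m * X + 1ℚᵘ))) + ((m * Y - (m * X + 1ℚᵘ)) + (m * Y - (m * X + 1ℚᵘ))))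
             + ((1ℚᵘ + 4× m * X) - 4× m * X')) + (((1ℚᵘ + 4× m * Y') - 4× m * Y) + 1ℚᵘ)
           ≃ 4× m * Y' - (4× m * X' + 1ℚᵘ)
    gaps = solve 5 (λ m X Y X' Y' →
             ((((m :* Y :- (m :* X :+ con 1ℚᵘ)) :+ (m :* Y :- (m :* X :+ con 1ℚᵘ)))
                :+ ((m :* Y :- (m :* X :+ con 1ℚᵘ)) :+ (m :* Y :- (m :* X :+ con 1ℚᵘ))))
               :+ ((con 1ℚᵘ :+ ((m :+ m) :+ (m :+ m)) :* X) :- ((m :+ m) :+ (m :+ m)) :* X'))
               :+ (((con 1ℚᵘ :+ ((m :+ m) :+ (m :+ m)) :* Y') :- ((m :+ m) :+ (m :+ m)) :* Y) :+ con 1ℚᵘ)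
             := ((m :+ m) :+ (m :+ m)) :* Y' :- (((m :+ m) :+ (m :+ m)) :* X' :+ con 1ℚᵘ)) ℚₚ.≃-refl

  -- If m A ≥ 1 + m B then A, B are 1/m apart, so 4m-close approximations of them are 1/(4m)-separated.
  ≮-Lessℚ : ∀ m A B A' B' → ¬ (m * A < 1ℚᵘ + m * B) → (4× m) * A < 1ℚᵘ + (4× m) * A' →
            (4× m) * B' < 1ℚᵘ + (4× m) * B → Lessℚ (4× m) B' A'
  ≮-Lessℚ m A B A' B' A≮ A'≈A B≈B' =
    <-by-gap (gaps m A B A' B') (+-pos (+-nonNeg-pos (+-nonNeg (+-nonNeg g g) (+-nonNeg g g)) (p<q⇒0<q-p A'≈A))
                                        (+-pos (p<q⇒0<q-p B≈B') 0<1))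
    where
    g = ≮⇒0≤p-q A≮
    gaps : ∀ m A B A' B' →
           ((((m * A - (1ℚᵘ + m * B)) + (m * A - (1ℚᵘ + m * B))) + ((m * A - (1ℚᵘ + m * B)) + (m * A - (1ℚᵘ + m * B))))
             + ((1ℚᵘ + 4× m * A') - 4× m * A)) + (((1ℚᵘ + 4× m * B) - 4× m * B') + 1ℚᵘ)
           ≃ 4× m * A' - (4× m * B' + 1ℚᵘ)
    gaps = solve 5 (λ m A B A' B' →
             ((((m :* A :- (con 1ℚᵘ :+ m :* B)) :+ (m :* A :- (con 1ℚᵘ :+ m :* B)))
                :+ ((m :* A :- (con 1ℚᵘ :+ m :* B)) :+ (m :* A :- (con 1ℚᵘ :+ m :* B))))
               :+ ((con 1ℚᵘ :+ ((m :+ m) :+ (m :+ m)) :* A') :- ((m :+ m) :+ (m :+ m)) :* A))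
               :+ (((con 1ℚᵘ :+ ((m :+ m) :+ (m :+ m)) :* B) :- ((m :+ m) :+ (m :+ m)) :* B') :+ con 1ℚᵘ)
             := ((m :+ m) :+ (m :+ m)) :* A' :- (((m :+ m) :+ (m :+ m)) :* B' :+ con 1ℚᵘ)) ℚₚ.≃-refl

  Lessℚ-0-* : ∀ m₁ m₂ X Y → Lessℚ m₁ 0ℚᵘ X → Lessℚ m₂ 0ℚᵘ Y → Lessℚ (m₁ * m₂) 0ℚᵘ (X * Y)
  Lessℚ-0-* m₁ m₂ X Y h₁ h₂ = <-by-gap (gaps m₁ m₂ X Y) (+-pos (+-pos (*-pos g₁ g₂) g₁) g₂)
    where
    g₁ = p<q⇒0<q-p h₁
    g₂ = p<q⇒0<q-p h₂
    gaps : ∀ m₁ m₂ X Y →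
           ((m₁ * X - (m₁ * 0ℚᵘ + 1ℚᵘ)) * (m₂ * Y - (m₂ * 0ℚᵘ + 1ℚᵘ)) + (m₁ * X - (m₁ * 0ℚᵘ + 1ℚᵘ)))
             + (m₂ * Y - (m₂ * 0ℚᵘ + 1ℚᵘ))
           ≃ (m₁ * m₂) * (X * Y) - ((m₁ * m₂) * 0ℚᵘ + 1ℚᵘ)
    gaps = solve 4 (λ m₁ m₂ X Y →
             ((m₁ :* X :- (m₁ :* con 0ℚᵘ :+ con 1ℚᵘ)) :* (m₂ :* Y :- (m₂ :* con 0ℚᵘ :+ con 1ℚᵘ))
               :+ (m₁ :* X :- (m₁ :* con 0ℚᵘ :+ con 1ℚᵘ))) :+ (m₂ :* Y :- (m₂ :* con 0ℚᵘ :+ con 1ℚᵘ))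
             := (m₁ :* m₂) :* (X :* Y) :- ((m₁ :* m₂) :* con 0ℚᵘ :+ con 1ℚᵘ)) ℚₚ.≃-refl

  ¬×⇒¬⊎¬ : ∀ {a b c d} → ¬ (a < b × c < d) → ¬ a < b ⊎ ¬ c < d
  ¬×⇒¬⊎¬ {a} {b} h with a ℚₚ.<? b
  ... | no a≮b = inj₁ a≮b
  ... | yes a<b = inj₂ (λ c<d → h (a<b , c<d))

  ¬Closeℚ-0⇒Apartℚ : ∀ m A B → ¬ Closeℚ m A 0ℚᵘ → Closeℚ (m + m) B A → Apartℚ (m + m) B
  ¬Closeℚ-0⇒Apartℚ m A B h (B≈A , A≈B) with ¬×⇒¬⊎¬ h
  ... | inj₁ A≮ = inj₁ (<-by-gap (gaps₁ m A B) (+-nonNeg-pos (+-nonNeg (≮⇒0≤p-q A≮) (≮⇒0≤p-q A≮)) (p<q⇒0<q-p A≈B)))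
    where
    gaps₁ : ∀ m A B → ((m * A - (1ℚᵘ + m * 0ℚᵘ)) + (m * A - (1ℚᵘ + m * 0ℚᵘ))) + ((1ℚᵘ + (m + m) * B) - (m + m) * A)
                     ≃ (m + m) * B - 1ℚᵘ
    gaps₁ = solve 3 (λ m A B →
              ((m :* A :- (con 1ℚᵘ :+ m :* con 0ℚᵘ)) :+ (m :* A :- (con 1ℚᵘ :+ m :* con 0ℚᵘ)))
                :+ ((con 1ℚᵘ :+ (m :+ m) :* B) :- (m :+ m) :* A)
              := (m :+ m) :* B :- con 1ℚᵘ) ℚₚ.≃-refl
  ... | inj₂ A≯ = inj₂ (<-by-gap (gaps₂ m A B) (+-nonNeg-pos (+-nonNeg (≮⇒0≤p-q A≯) (≮⇒0≤p-q A≯)) (p<q⇒0<q-p B≈A)))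
    where
    gaps₂ : ∀ m A B → ((m * 0ℚᵘ - (1ℚᵘ + m * A)) + (m * 0ℚᵘ - (1ℚᵘ + m * A))) + ((1ℚᵘ + (m + m) * A) - (m + m) * B)
                     ≃ (m + m) * (- B) - 1ℚᵘ
    gaps₂ = solve 3 (λ m A B →
              ((m :* con 0ℚᵘ :- (con 1ℚᵘ :+ m :* A)) :+ (m :* con 0ℚᵘ :- (con 1ℚᵘ :+ m :* A)))
                :+ ((con 1ℚᵘ :+ (m :+ m) :* A) :- (m :+ m) :* B)
              := (m :+ m) :* (:- B) :- con 1ℚᵘ) ℚₚ.≃-refl

  p≤∣p∣ : ∀ p → p ≤ ∣ p ∣
  p≤∣p∣ p@(mkℚᵘ (+ n) d)     = ℚₚ.≤-refl
  p≤∣p∣ p@(mkℚᵘ -[1+ n ] d) = ℚₚ.<⇒≤ (ℚₚ.<-≤-trans (ℚₚ.negative⁻¹ p) (ℚₚ.0≤∣p∣ p))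

  -p≤∣p∣ : ∀ p → - p ≤ ∣ p ∣
  -p≤∣p∣ p = ℚₚ.≤-respʳ-≃ (ℚₚ.∣-p∣≃∣p∣ p) (p≤∣p∣ (- p))

  ∣∣-nonNeg : ∀ p → ℚ.NonNegative ∣ p ∣
  ∣∣-nonNeg p = ℚ.nonNegative (ℚₚ.0≤∣p∣ p)

  ∣mX-mY∣≃m∣X-Y∣ : ∀ m X Y → 0ℚᵘ ≤ m → ∣ m * X - m * Y ∣ ≃ m * ∣ X - Y ∣
  ∣mX-mY∣≃m∣X-Y∣ m X Y 0≤m =
    ℚₚ.≃-trans (ℚₚ.∣-∣-cong (factor m X Y))
      (ℚₚ.≃-trans (ℚₚ.∣p*q∣≃∣p∣*∣q∣ m (X - Y)) (ℚₚ.*-congʳ (ℚₚ.0≤p⇒∣p∣≃p 0≤m)))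
    where
    factor : ∀ m X Y → m * X - m * Y ≃ m * (X - Y)
    factor = solve 3 (λ m X Y → m :* X :- m :* Y := m :* (X :- Y)) ℚₚ.≃-refl

  private
    gap₁ : ∀ m X Y → (1ℚᵘ + m * Y) - m * X ≃ 1ℚᵘ - (m * X - m * Y)
    gap₁ = solve 3 (λ m X Y → (con 1ℚᵘ :+ m :* Y) :- m :* X := con 1ℚᵘ :- (m :* X :- m :* Y)) ℚₚ.≃-refl

    gap₂ : ∀ m X Y → (1ℚᵘ + m * X) - m * Y ≃ 1ℚᵘ - (- (m * X - m * Y))
    gap₂ = solve 3 (λ m X Y → (con 1ℚᵘ :+ m :* X) :- m :* Y := con 1ℚᵘ :- (:- (m :* X :- m :* Y))) ℚₚ.≃-refl

  Closeℚ⇒∣-∣<1 : ∀ m X Y → 0ℚᵘ ≤ m → Closeℚ m X Y → m * ∣ X - Y ∣ < 1ℚᵘ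
  Closeℚ⇒∣-∣<1 m X Y 0≤m (h₁ , h₂) with ℚₚ.∣p∣≡p∨∣p∣≡-p (m * X - m * Y)
  ... | inj₁ ∣d∣≡d  = <-resp₂-≃ (∣mX-mY∣≃m∣X-Y∣ m X Y 0≤m) ℚₚ.≃-refl
                        (subst (_< 1ℚᵘ) (sym ∣d∣≡d) (<-by-gap (gap₁ m X Y) (p<q⇒0<q-p h₁)))
  ... | inj₂ ∣d∣≡-d = <-resp₂-≃ (∣mX-mY∣≃m∣X-Y∣ m X Y 0≤m) ℚₚ.≃-refl
                        (subst (_< 1ℚᵘ) (sym ∣d∣≡-d) (<-by-gap (gap₂ m X Y) (p<q⇒0<q-p h₂)))

  ∣-∣<1⇒Closeℚ : ∀ m X Y → 0ℚᵘ ≤ m → m * ∣ X - Y ∣ < 1ℚᵘ → Closeℚ m X Y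
  ∣-∣<1⇒Closeℚ m X Y 0≤m h =
    <-by-gap (ℚₚ.≃-sym (gap₁ m X Y)) (p<q⇒0<q-p (ℚₚ.≤-<-trans (p≤∣p∣ _) ∣d∣<1)) ,
    <-by-gap (ℚₚ.≃-sym (gap₂ m X Y)) (p<q⇒0<q-p (ℚₚ.≤-<-trans (-p≤∣p∣ _) ∣d∣<1))
    where
    ∣d∣<1 : ∣ m * X - m * Y ∣ < 1ℚᵘ
    ∣d∣<1 = <-resp₂-≃ (ℚₚ.≃-sym (∣mX-mY∣≃m∣X-Y∣ m X Y 0≤m)) ℚₚ.≃-refl h

  open ℚₚ.≤-Reasoning

  ∣X∣≤∣X₀∣+1 : ∀ X X₀ → 1ℚᵘ * ∣ X - X₀ ∣ < 1ℚᵘ → ∣ X ∣ ≤ ∣ X₀ ∣ + 1ℚᵘ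
  ∣X∣≤∣X₀∣+1 X X₀ h = begin
    ∣ X ∣                 ≃⟨ ℚₚ.∣-∣-cong (split X X₀) ⟩
    ∣ X₀ + (X - X₀) ∣     ≤⟨ ℚₚ.∣p+q∣≤∣p∣+∣q∣ X₀ (X - X₀) ⟩
    ∣ X₀ ∣ + ∣ X - X₀ ∣   ≤⟨ ℚₚ.+-monoʳ-≤ ∣ X₀ ∣ (ℚₚ.<⇒≤ (<-resp₂-≃ (ℚₚ.*-identityˡ _) ℚₚ.≃-refl h)) ⟩
    ∣ X₀ ∣ + 1ℚᵘ          ∎
    where
    split : ∀ X X₀ → X ≃ X₀ + (X - X₀)
    split = solve 2 (λ X X₀ → X := X₀ :+ (X :- X₀)) ℚₚ.≃-refl

  -- The product estimate |XY - X'Y'| ≤ |X| |Y - Y'| + |Y'| |X - X'|.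
  ∣-∣<1-* : ∀ m H X X' Y Y' → 0ℚᵘ ≤ m → ∣ X ∣ ≤ H → ∣ Y' ∣ ≤ H →
            ((m * H) + (m * H)) * ∣ X - X' ∣ < 1ℚᵘ → ((m * H) + (m * H)) * ∣ Y - Y' ∣ < 1ℚᵘ →
            m * ∣ X * Y - X' * Y' ∣ < 1ℚᵘ
  ∣-∣<1-* m H X X' Y Y' 0≤m ∣X∣≤H ∣Y'∣≤H hX hY = half (begin-strict
      u + u                                               ≤⟨ ℚₚ.+-mono-≤ u≤ u≤ ⟩
      m * (H * dY + H * dX) + m * (H * dY + H * dX)       ≃⟨ regroup m H dX dY ⟩
      ((m * H) + (m * H)) * dY + ((m * H) + (m * H)) * dX <⟨ ℚₚ.+-mono-< hY hX ⟩
      1ℚᵘ + 1ℚᵘ                                           ∎)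
    where
    dX = ∣ X - X' ∣
    dY = ∣ Y - Y' ∣
    u = m * ∣ X * Y - X' * Y' ∣
    split : ∀ X X' Y Y' → X * Y - X' * Y' ≃ X * (Y - Y') + Y' * (X - X')
    split = solve 4 (λ X X' Y Y' → X :* Y :- X' :* Y' := X :* (Y :- Y') :+ Y' :* (X :- X')) ℚₚ.≃-refl
    u≤ : u ≤ m * (H * dY + H * dX)
    u≤ = ℚₚ.*-monoʳ-≤-nonNeg m {{ℚ.nonNegative 0≤m}} (begin
      ∣ X * Y - X' * Y' ∣                  ≃⟨ ℚₚ.∣-∣-cong (split X X' Y Y') ⟩
      ∣ X * (Y - Y') + Y' * (X - X') ∣     ≤⟨ ℚₚ.∣p+q∣≤∣p∣+∣q∣ (X * (Y - Y')) (Y' * (X - X')) ⟩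
      ∣ X * (Y - Y') ∣ + ∣ Y' * (X - X') ∣ ≃⟨ ℚₚ.+-cong (ℚₚ.∣p*q∣≃∣p∣*∣q∣ X (Y - Y')) (ℚₚ.∣p*q∣≃∣p∣*∣q∣ Y' (X - X')) ⟩
      ∣ X ∣ * dY + ∣ Y' ∣ * dX             ≤⟨ ℚₚ.+-mono-≤ (ℚₚ.*-monoˡ-≤-nonNeg dY {{∣∣-nonNeg (Y - Y')}} ∣X∣≤H)
                                                          (ℚₚ.*-monoˡ-≤-nonNeg dX {{∣∣-nonNeg (X - X')}} ∣Y'∣≤H) ⟩
      H * dY + H * dX                      ∎)
    regroup : ∀ m H dX dY → m * (H * dY + H * dX) + m * (H * dY + H * dX)
                          ≃ ((m * H) + (m * H)) * dY + ((m * H) + (m * H)) * dX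
    regroup = solve 4 (λ m H dX dY → m :* (H :* dY :+ H :* dX) :+ m :* (H :* dY :+ H :* dX)
                                  := ((m :* H) :+ (m :* H)) :* dY :+ ((m :* H) :+ (m :* H)) :* dX) ℚₚ.≃-refl
    half : u + u < 1ℚᵘ + 1ℚᵘ → u < 1ℚᵘ
    half h = <-by-gap ℚₚ.≃-refl (0<p+p⇒0<p (<-resp₂-≃ ℚₚ.≃-refl (twice u) (p<q⇒0<q-p h)))
      where
      twice : ∀ u → (1ℚᵘ + 1ℚᵘ) - (u + u) ≃ (1ℚᵘ - u) + (1ℚᵘ - u)
      twice = solve 1 (λ u → (con 1ℚᵘ :+ con 1ℚᵘ) :- (u :+ u) := (con 1ℚᵘ :- u) :+ (con 1ℚᵘ :- u)) ℚₚ.≃-refl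

  Apartℚ⇒1<c∣X∣ : ∀ c X → 0ℚᵘ ≤ c → Apartℚ c X → 1ℚᵘ < c * ∣ X ∣
  Apartℚ⇒1<c∣X∣ c X 0≤c (inj₁ h) = ℚₚ.<-≤-trans h (ℚₚ.*-monoʳ-≤-nonNeg c {{ℚ.nonNegative 0≤c}} (p≤∣p∣ X))
  Apartℚ⇒1<c∣X∣ c X 0≤c (inj₂ h) = ℚₚ.<-≤-trans h (ℚₚ.*-monoʳ-≤-nonNeg c {{ℚ.nonNegative 0≤c}} (-p≤∣p∣ X))

  ∣inverse∣≤ : ∀ c A R → 1ℚᵘ < c * ∣ A ∣ → R * A ≃ 1ℚᵘ → ∣ R ∣ ≤ c
  ∣inverse∣≤ c A R 1<c∣A∣ RA≃1 with c ℚₚ.<? ∣ R ∣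
  ... | no c≮∣R∣ = ℚₚ.≮⇒≥ c≮∣R∣
  ... | yes c<∣R∣ = ⊥-elim (ℚₚ.<-irrefl ℚₚ.≃-refl (ℚₚ.<-≤-trans 1<c∣A∣ (begin
    c * ∣ A ∣     ≤⟨ ℚₚ.*-monoˡ-≤-nonNeg ∣ A ∣ {{∣∣-nonNeg A}} (ℚₚ.<⇒≤ c<∣R∣) ⟩
    ∣ R ∣ * ∣ A ∣ ≃⟨ ℚₚ.≃-sym (ℚₚ.∣p*q∣≃∣p∣*∣q∣ R A) ⟩
    ∣ R * A ∣     ≃⟨ ℚₚ.∣-∣-cong RA≃1 ⟩
    1ℚᵘ           ∎)))

  -- The inverse estimate |1/A - 1/B| = |A - B| / |A B| ≤ c² |A - B|.
  ∣-∣<1-inverse : ∀ m c A B R S → 0ℚᵘ ≤ m → 1ℚᵘ < c * ∣ A ∣ → 1ℚᵘ < c * ∣ B ∣ →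
                  R * A ≃ 1ℚᵘ → S * B ≃ 1ℚᵘ → ((c * c) * m) * ∣ A - B ∣ < 1ℚᵘ → m * ∣ R - S ∣ < 1ℚᵘ
  ∣-∣<1-inverse m c A B R S 0≤m 1<c∣A∣ 1<c∣B∣ RA≃1 SB≃1 h = ℚₚ.≤-<-trans (begin
    m * ∣ R - S ∣                   ≤⟨ ℚₚ.*-monoʳ-≤-nonNeg m {{ℚ.nonNegative 0≤m}} ∣R-S∣≤ ⟩
    m * ((c * c) * ∣ A - B ∣)       ≃⟨ reassoc m c ∣ A - B ∣ ⟩
    ((c * c) * m) * ∣ A - B ∣       ∎) h
    where
    R-S≃ : R - S ≃ (R * S) * (- (A - B))
    R-S≃ = ℚₚ.≃-trans (ℚₚ.≃-sym (*1 R S))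
             (ℚₚ.≃-trans (ℚₚ.+-cong (ℚₚ.*-congˡ {R} (ℚₚ.≃-sym SB≃1)) (ℚₚ.-‿cong (ℚₚ.*-congˡ {S} (ℚₚ.≃-sym RA≃1))))
               (expand R S A B))
      where
      *1 : ∀ R S → R * 1ℚᵘ - S * 1ℚᵘ ≃ R - S
      *1 = solve 2 (λ R S → R :* con 1ℚᵘ :- S :* con 1ℚᵘ := R :- S) ℚₚ.≃-refl
      expand : ∀ R S A B → R * (S * B) - S * (R * A) ≃ (R * S) * (- (A - B))
      expand = solve 4 (λ R S A B → R :* (S :* B) :- S :* (R :* A) := (R :* S) :* (:- (A :- B))) ℚₚ.≃-refl
    ∣R-S∣≤ : ∣ R - S ∣ ≤ (c * c) * ∣ A - B ∣
    ∣R-S∣≤ = begin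
      ∣ R - S ∣                    ≃⟨ ℚₚ.∣-∣-cong R-S≃ ⟩
      ∣ (R * S) * (- (A - B)) ∣    ≃⟨ ℚₚ.∣p*q∣≃∣p∣*∣q∣ (R * S) _ ⟩
      ∣ R * S ∣ * ∣ - (A - B) ∣    ≃⟨ ℚₚ.*-cong (ℚₚ.∣p*q∣≃∣p∣*∣q∣ R S) (ℚₚ.∣-p∣≃∣p∣ (A - B)) ⟩
      (∣ R ∣ * ∣ S ∣) * ∣ A - B ∣  ≤⟨ ℚₚ.*-monoˡ-≤-nonNeg ∣ A - B ∣ {{∣∣-nonNeg (A - B)}}
                                      (ℚₚ.*-mono-≤-nonNeg {{∣∣-nonNeg R}} {{∣∣-nonNeg S}}
                                        (∣inverse∣≤ c A R 1<c∣A∣ RA≃1) (∣inverse∣≤ c B S 1<c∣B∣ SB≃1)) ⟩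
      (c * c) * ∣ A - B ∣          ∎
    reassoc : ∀ m c d → m * ((c * c) * d) ≃ ((c * c) * m) * d
    reassoc = solve 3 (λ m c d → m :* ((c :* c) :* d) := ((c :* c) :* m) :* d) ℚₚ.≃-refl

module ToRational where
  open KM ℕ-str
  open FracOps ℕ-str using (NonzeroDen; neg; Less)
  open RationalEstimates using (Closeℚ; Lessℚ; <-resp₂-≃)
  open ℚ using (_+_; _*_; -_; 0ℚᵘ; 1ℚᵘ)

  toℤ : ZM → ℤ
  toℤ (p , q) = + p ℤ.- + q

  toℤ-+ᶻ : ∀ a c → toℤ (a +ᶻ c) ≡ toℤ a ℤ.+ toℤ c
  toℤ-+ᶻ (p , q) (r , s) =
    trans (cong₂ ℤ._-_ (ℤₚ.pos-+ p r) (ℤₚ.pos-+ q s)) (regroup (+ p) (+ q) (+ r) (+ s))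
    where
    regroup : ∀ a b c d → (a ℤ.+ c) ℤ.- (b ℤ.+ d) ≡ (a ℤ.- b) ℤ.+ (c ℤ.- d)
    regroup = solve-∀

  toℤ-·ᶻ : ∀ a c → toℤ (a ·ᶻ c) ≡ toℤ a ℤ.* toℤ c
  toℤ-·ᶻ (p , q) (r , s) =
    trans (cong₂ ℤ._-_ (trans (ℤₚ.pos-+ (p ℕ.* r) (q ℕ.* s)) (cong₂ ℤ._+_ (ℤₚ.pos-* p r) (ℤₚ.pos-* q s)))
                       (trans (ℤₚ.pos-+ (p ℕ.* s) (q ℕ.* r)) (cong₂ ℤ._+_ (ℤₚ.pos-* p s) (ℤₚ.pos-* q r))))
          (expand (+ p) (+ q) (+ r) (+ s))
    where
    expand : ∀ a b c d → (a ℤ.* c ℤ.+ b ℤ.* d) ℤ.- (a ℤ.* d ℤ.+ b ℤ.* c) ≡ (a ℤ.- b) ℤ.* (c ℤ.- d)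
    expand = solve-∀

  toℤ-ι : ∀ n → toℤ (ι n) ≡ + n
  toℤ-ι n = ℤₚ.+-identityʳ (+ n)

  toℤ-·ι : ∀ a n → toℤ (a ·ᶻ ι n) ≡ toℤ a ℤ.* + n
  toℤ-·ι a n = trans (toℤ-·ᶻ a (ι n)) (cong (toℤ a ℤ.*_) (toℤ-ι n))

  -- a - b < c - d in ℤ is a + d < c + b, which is how <ᶻ is defined.
  <ᶻ⇔< : ∀ a c → a <ᶻ c ⇔ toℤ a ℤ.< toℤ c
  <ᶻ⇔< (p , q) (r , s) = mk⇔
    (λ h → subst₂ ℤ._<_ (cancel (+ p) (+ q) (+ s)) (cancel' (+ r) (+ s) (+ q))
                  (ℤₚ.+-monoˡ-< (ℤ.- (+ q ℤ.+ + s)) (subst₂ ℤ._<_ (ℤₚ.pos-+ p s) (ℤₚ.pos-+ r q) (ℤ.+<+ h))))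
    (λ h → ℤₚ.drop‿+<+ (subst₂ ℤ._<_ (sym (ℤₚ.pos-+ p s)) (sym (ℤₚ.pos-+ r q))
             (subst₂ ℤ._<_ (uncancel (+ p) (+ q) (+ s)) (uncancel' (+ r) (+ s) (+ q))
               (ℤₚ.+-monoˡ-< (+ q ℤ.+ + s) h))))
    where
    cancel : ∀ a b d → (a ℤ.+ d) ℤ.+ ℤ.- (b ℤ.+ d) ≡ a ℤ.- b
    cancel = solve-∀
    cancel' : ∀ c d b → (c ℤ.+ b) ℤ.+ ℤ.- (b ℤ.+ d) ≡ c ℤ.- d
    cancel' = solve-∀
    uncancel : ∀ a b d → (a ℤ.- b) ℤ.+ (b ℤ.+ d) ≡ a ℤ.+ d
    uncancel = solve-∀
    uncancel' : ∀ c d b → (c ℤ.- d) ℤ.+ (b ℤ.+ d) ≡ c ℤ.+ b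
    uncancel' = solve-∀

  -- Only meaningful for nonzero denominators: a denominator b is read as 1 + pred b.
  toℚ : Frac → ℚᵘ
  toℚ (a , b) = mkℚᵘ (toℤ a) (ℕ.pred b)

  ℕ→ℚ : ℕ → ℚᵘ
  ℕ→ℚ n = mkℚᵘ (+ n) 0

  <ꟳ⇔< : ∀ x y → NonzeroDen x → NonzeroDen y → x <ꟳ y ⇔ toℚ x ℚ.< toℚ y
  <ꟳ⇔< (a , zero)  _          a≠0 _   = ⊥-elim (a≠0 refl)
  <ꟳ⇔< (a , suc b) (c , zero)  _  c≠0 = ⊥-elim (c≠0 refl)
  <ꟳ⇔< (a , suc b) (c , suc d) _  _   = mk⇔
    (λ h → *<* (subst₂ ℤ._<_ (toℤ-·ι a (suc d)) (toℤ-·ι c (suc b)) (Equivalence.to cross h)))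
    (λ { (*<* h) → Equivalence.from cross (subst₂ ℤ._<_ (sym (toℤ-·ι a (suc d))) (sym (toℤ-·ι c (suc b))) h) })
    where
    cross = <ᶻ⇔< (a ·ᶻ ι (suc d)) (c ·ᶻ ι (suc b))

  NonzeroDen-+ꟳ : ∀ x y → NonzeroDen x → NonzeroDen y → NonzeroDen (x +ꟳ y)
  NonzeroDen-+ꟳ (a , zero)  _           a≠0 _   = ⊥-elim (a≠0 refl)
  NonzeroDen-+ꟳ (a , suc b) (c , zero)  _   c≠0 = ⊥-elim (c≠0 refl)
  NonzeroDen-+ꟳ (a , suc b) (c , suc d) _   _   ()

  NonzeroDen-·ꟳ : ∀ x y → NonzeroDen x → NonzeroDen y → NonzeroDen (x ·ꟳ y)
  NonzeroDen-·ꟳ (a , zero)  _           a≠0 _   = ⊥-elim (a≠0 refl)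
  NonzeroDen-·ꟳ (a , suc b) (c , zero)  _   c≠0 = ⊥-elim (c≠0 refl)
  NonzeroDen-·ꟳ (a , suc b) (c , suc d) _   _   ()

  NonzeroDen-1ꟳ : NonzeroDen 1ꟳ
  NonzeroDen-1ꟳ ()

  NonzeroDen-0ꟳ : NonzeroDen 0ꟳ
  NonzeroDen-0ꟳ ()

  toℚ-+ꟳ : ∀ x y → NonzeroDen x → NonzeroDen y → toℚ (x +ꟳ y) ≃ toℚ x + toℚ y
  toℚ-+ꟳ (a , zero)  _           a≠0 _   = ⊥-elim (a≠0 refl)
  toℚ-+ꟳ (a , suc b) (c , zero)  _   c≠0 = ⊥-elim (c≠0 refl)
  toℚ-+ꟳ (a , suc b) (c , suc d) _   _   = *≡* (cong (ℤ._* (+ (suc b ℕ.* suc d))) numerator)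
    where
    numerator : toℤ ((a ·ᶻ ι (suc d)) +ᶻ (ι (suc b) ·ᶻ c)) ≡ toℤ a ℤ.* + suc d ℤ.+ toℤ c ℤ.* + suc b
    numerator = trans (toℤ-+ᶻ (a ·ᶻ ι (suc d)) (ι (suc b) ·ᶻ c))
      (cong₂ ℤ._+_ (toℤ-·ι a (suc d))
        (trans (toℤ-·ᶻ (ι (suc b)) c) (trans (cong (ℤ._* toℤ c) (toℤ-ι (suc b))) (ℤₚ.*-comm (+ suc b) (toℤ c)))))

  toℚ-·ꟳ : ∀ x y → NonzeroDen x → NonzeroDen y → toℚ (x ·ꟳ y) ≃ toℚ x * toℚ y
  toℚ-·ꟳ (a , zero)  _           a≠0 _   = ⊥-elim (a≠0 refl)
  toℚ-·ꟳ (a , suc b) (c , zero)  _   c≠0 = ⊥-elim (c≠0 refl)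
  toℚ-·ꟳ (a , suc b) (c , suc d) _   _   = *≡* (cong (ℤ._* (+ (suc b ℕ.* suc d))) (toℤ-·ᶻ a c))

  toℚ-scale : ∀ m x → NonzeroDen x → toℚ (scale m x) ≃ ℕ→ℚ m * toℚ x
  toℚ-scale m (a , zero)  a≠0 = ⊥-elim (a≠0 refl)
  toℚ-scale m (a , suc b) _   =
    *≡* (cong₂ ℤ._*_ (trans (toℤ-·ᶻ (ι m) a) (cong (ℤ._* toℤ a) (toℤ-ι m)))
                     (cong (λ k → + suc k) (ℕₚ.+-identityʳ b)))

  toℚ-neg : ∀ x → NonzeroDen x → toℚ (neg x) ≃ - toℚ x
  toℚ-neg ((p , q) , zero)  x≠0 = ⊥-elim (x≠0 refl)
  toℚ-neg ((p , q) , suc b) _   = *≡* (cong (ℤ._* + suc b) (swap (+ p) (+ q)))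
    where
    swap : ∀ a c → c ℤ.- a ≡ ℤ.- (a ℤ.- c)
    swap = solve-∀

  toℚ-1ꟳ : toℚ 1ꟳ ≃ 1ℚᵘ
  toℚ-1ꟳ = *≡* refl

  toℚ-0ꟳ : toℚ 0ꟳ ≃ 0ℚᵘ
  toℚ-0ꟳ = *≡* refl

  ℕ→ℚ-+ : ∀ a b → ℕ→ℚ (a ℕ.+ b) ≃ ℕ→ℚ a + ℕ→ℚ b
  ℕ→ℚ-+ a b = *≡* (cong (ℤ._* + 1) (trans (ℤₚ.pos-+ a b)
                     (sym (cong₂ ℤ._+_ (ℤₚ.*-identityʳ (+ a)) (ℤₚ.*-identityʳ (+ b))))))

  ℕ→ℚ-* : ∀ a b → ℕ→ℚ (a ℕ.* b) ≃ ℕ→ℚ a * ℕ→ℚ b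
  ℕ→ℚ-* a b = *≡* (cong (ℤ._* + 1) (ℤₚ.pos-* a b))

  ℕ→ℚ-nonNeg : ∀ a → 0ℚᵘ ℚ.≤ ℕ→ℚ a
  ℕ→ℚ-nonNeg a = ℚₚ.nonNegative⁻¹ (ℕ→ℚ a)

  ℕ→ℚ-mono-≤ : ∀ {a b} → a ℕ.≤ b → ℕ→ℚ a ℚ.≤ ℕ→ℚ b
  ℕ→ℚ-mono-≤ {a} {b} a≤b =
    *≤* (subst₂ ℤ._≤_ (sym (ℤₚ.*-identityʳ (+ a))) (sym (ℤₚ.*-identityʳ (+ b))) (ℤ.+≤+ a≤b))

  <ꟳ⇔<-≃ : ∀ x y {X Y} → NonzeroDen x → NonzeroDen y → toℚ x ≃ X → toℚ y ≃ Y → x <ꟳ y ⇔ X ℚ.< Y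
  <ꟳ⇔<-≃ x y x≠0 y≠0 x≃X y≃Y = mk⇔
    (λ h → <-resp₂-≃ x≃X y≃Y (Equivalence.to (<ꟳ⇔< x y x≠0 y≠0) h))
    (λ h → Equivalence.from (<ꟳ⇔< x y x≠0 y≠0) (<-resp₂-≃ (ℚₚ.≃-sym x≃X) (ℚₚ.≃-sym y≃Y) h))

  scale<1ꟳ+scale⇔ : ∀ m x y → NonzeroDen x → NonzeroDen y →
                    scale m x <ꟳ (1ꟳ +ꟳ scale m y) ⇔ ℕ→ℚ m * toℚ x ℚ.< 1ℚᵘ + ℕ→ℚ m * toℚ y
  scale<1ꟳ+scale⇔ m x y x≠0 y≠0 =
    <ꟳ⇔<-≃ (scale m x) (1ꟳ +ꟳ scale m y) x≠0 (NonzeroDen-+ꟳ 1ꟳ (scale m y) NonzeroDen-1ꟳ y≠0)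
      (toℚ-scale m x x≠0)
      (ℚₚ.≃-trans (toℚ-+ꟳ 1ꟳ (scale m y) NonzeroDen-1ꟳ y≠0) (ℚₚ.+-cong toℚ-1ꟳ (toℚ-scale m y y≠0)))

  Close⇔Closeℚ : ∀ m x y → NonzeroDen x → NonzeroDen y → Close m x y ⇔ Closeℚ (ℕ→ℚ m) (toℚ x) (toℚ y)
  Close⇔Closeℚ m x y x≠0 y≠0 = mk⇔
    (λ (h₁ , h₂) → Equivalence.to (scale<1ꟳ+scale⇔ m x y x≠0 y≠0) h₁ ,
                   Equivalence.to (scale<1ꟳ+scale⇔ m y x y≠0 x≠0) h₂)
    (λ (h₁ , h₂) → Equivalence.from (scale<1ꟳ+scale⇔ m x y x≠0 y≠0) h₁ ,
                   Equivalence.from (scale<1ꟳ+scale⇔ m y x y≠0 x≠0) h₂)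

  Less⇔Lessℚ : ∀ m x y → NonzeroDen x → NonzeroDen y → Less m x y ⇔ Lessℚ (ℕ→ℚ m) (toℚ x) (toℚ y)
  Less⇔Lessℚ m x y x≠0 y≠0 =
    <ꟳ⇔<-≃ (scale m x +ꟳ 1ꟳ) (scale m y) (NonzeroDen-+ꟳ (scale m x) 1ꟳ x≠0 NonzeroDen-1ꟳ) y≠0
      (ℚₚ.≃-trans (toℚ-+ꟳ (scale m x) 1ꟳ x≠0 NonzeroDen-1ꟳ) (ℚₚ.+-cong (toℚ-scale m x x≠0) toℚ-1ꟳ))
      (toℚ-scale m y y≠0)

module NatFacts where
  open KM ℕ-str
  open FracOps ℕ-str
  open RationalEstimates
  open ToRational
  open ℚ using (_+_; _*_; _-_; -_; ∣_∣; 0ℚᵘ; 1ℚᵘ)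
  open ℚₚ.≃-Reasoning

  private
    toClose : ∀ m x y {X Y} → NonzeroDen x → NonzeroDen y → toℚ x ≃ X → toℚ y ≃ Y →
              Closeℚ (ℕ→ℚ m) X Y → Close m x y
    toClose m x y {X} {Y} x≠0 y≠0 x≃X y≃Y h = Equivalence.from (Close⇔Closeℚ m x y x≠0 y≠0)
      (Closeℚ-cong {ℕ→ℚ m} {ℕ→ℚ m} {X} {toℚ x} {Y} {toℚ y} ℚₚ.≃-refl (ℚₚ.≃-sym x≃X) (ℚₚ.≃-sym y≃Y) h)

    fromClose : ∀ m x y {q} → NonzeroDen x → NonzeroDen y → ℕ→ℚ m ≃ q →
                Close m x y → Closeℚ q (toℚ x) (toℚ y)
    fromClose m x y {q} x≠0 y≠0 m≃q h = Closeℚ-cong {ℕ→ℚ m} {q} {toℚ x} {toℚ x} {toℚ y} {toℚ y}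
      m≃q ℚₚ.≃-refl ℚₚ.≃-refl (Equivalence.to (Close⇔Closeℚ m x y x≠0 y≠0) h)

    toLess : ∀ m x y {q X Y} → NonzeroDen x → NonzeroDen y → q ≃ ℕ→ℚ m → toℚ x ≃ X → toℚ y ≃ Y →
             Lessℚ q X Y → Less m x y
    toLess m x y {q} {X} {Y} x≠0 y≠0 q≃m x≃X y≃Y h = Equivalence.from (Less⇔Lessℚ m x y x≠0 y≠0)
      (Lessℚ-cong {q} {ℕ→ℚ m} {X} {toℚ x} {Y} {toℚ y} q≃m (ℚₚ.≃-sym x≃X) (ℚₚ.≃-sym y≃Y) h)

    fromLess : ∀ m x y {X} → NonzeroDen x → NonzeroDen y → toℚ x ≃ X → Less m x y → Lessℚ (ℕ→ℚ m) X (toℚ y)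
    fromLess m x y {X} x≠0 y≠0 x≃X h = Lessℚ-cong {ℕ→ℚ m} {ℕ→ℚ m} {toℚ x} {X} {toℚ y} {toℚ y}
      ℚₚ.≃-refl x≃X ℚₚ.≃-refl (Equivalence.to (Less⇔Lessℚ m x y x≠0 y≠0) h)

    ℕ→ℚ-double : ∀ m → ℕ→ℚ (m ℕ.+ m) ≃ ℕ→ℚ m + ℕ→ℚ m
    ℕ→ℚ-double m = ℕ→ℚ-+ m m

    ℕ→ℚ-fourfold : ∀ m → ℕ→ℚ (fourfold m) ≃ 4× (ℕ→ℚ m)
    ℕ→ℚ-fourfold m = ℚₚ.≃-trans (ℕ→ℚ-+ (m ℕ.+ m) (m ℕ.+ m)) (ℚₚ.+-cong (ℕ→ℚ-double m) (ℕ→ℚ-double m))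

  ≃⇒Close : ∀ m x y → NonzeroDen x → NonzeroDen y → toℚ x ≃ toℚ y → Close m x y
  ≃⇒Close m x y x≠0 y≠0 x≃y = toClose m x y x≠0 y≠0 ℚₚ.≃-refl ℚₚ.≃-refl (≃⇒Closeℚ (ℕ→ℚ m) x≃y)

  Close-refl : ∀ m x → NonzeroDen x → Close m x x
  Close-refl m x x≠0 = ≃⇒Close m x x x≠0 x≠0 ℚₚ.≃-refl

  Close-trans : ∀ m x y z → NonzeroDen x → NonzeroDen y → NonzeroDen z →
                Close (m ℕ.+ m) x y → Close (m ℕ.+ m) y z → Close m x z
  Close-trans m x y z x≠0 y≠0 z≠0 x≈y y≈z = toClose m x z x≠0 z≠0 ℚₚ.≃-refl ℚₚ.≃-refl
    (Closeℚ-trans (ℕ→ℚ m) (toℚ x) (toℚ y) (toℚ z)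
      (fromClose (m ℕ.+ m) x y x≠0 y≠0 (ℕ→ℚ-double m) x≈y) (fromClose (m ℕ.+ m) y z y≠0 z≠0 (ℕ→ℚ-double m) y≈z))

  Close-+ꟳ : ∀ m x x' y y' → NonzeroDen x → NonzeroDen x' → NonzeroDen y → NonzeroDen y' →
             Close (m ℕ.+ m) x x' → Close (m ℕ.+ m) y y' → Close m (x +ꟳ y) (x' +ꟳ y')
  Close-+ꟳ m x x' y y' x≠0 x'≠0 y≠0 y'≠0 x≈x' y≈y' =
    toClose m (x +ꟳ y) (x' +ꟳ y') (NonzeroDen-+ꟳ x y x≠0 y≠0) (NonzeroDen-+ꟳ x' y' x'≠0 y'≠0)
      (toℚ-+ꟳ x y x≠0 y≠0) (toℚ-+ꟳ x' y' x'≠0 y'≠0)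
      (Closeℚ-+ (ℕ→ℚ m) (toℚ x) (toℚ x') (toℚ y) (toℚ y')
        (fromClose (m ℕ.+ m) x x' x≠0 x'≠0 (ℕ→ℚ-double m) x≈x')
        (fromClose (m ℕ.+ m) y y' y≠0 y'≠0 (ℕ→ℚ-double m) y≈y'))

  Close-neg : ∀ m x y → NonzeroDen x → NonzeroDen y → Close m x y → Close m (neg x) (neg y)
  Close-neg m x y x≠0 y≠0 x≈y = toClose m (neg x) (neg y) x≠0 y≠0 (toℚ-neg x x≠0) (toℚ-neg y y≠0)
    (Closeℚ-neg (ℕ→ℚ m) (toℚ x) (toℚ y) (fromClose m x y x≠0 y≠0 ℚₚ.≃-refl x≈y))

  +ꟳ-assoc : ∀ m x y z → NonzeroDen x → NonzeroDen y → NonzeroDen z →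
             Close m ((x +ꟳ y) +ꟳ z) (x +ꟳ (y +ꟳ z))
  +ꟳ-assoc m x y z x≠0 y≠0 z≠0 = ≃⇒Close m _ _
    (NonzeroDen-+ꟳ (x +ꟳ y) z x+y≠0 z≠0) (NonzeroDen-+ꟳ x (y +ꟳ z) x≠0 y+z≠0) (begin
      toℚ ((x +ꟳ y) +ꟳ z)        ≈⟨ toℚ-+ꟳ (x +ꟳ y) z x+y≠0 z≠0 ⟩
      toℚ (x +ꟳ y) + toℚ z       ≈⟨ ℚₚ.+-congˡ (toℚ z) (toℚ-+ꟳ x y x≠0 y≠0) ⟩
      (toℚ x + toℚ y) + toℚ z    ≈⟨ ℚₚ.+-assoc (toℚ x) (toℚ y) (toℚ z) ⟩
      toℚ x + (toℚ y + toℚ z)    ≈⟨ ℚₚ.+-congʳ (toℚ x) (toℚ-+ꟳ y z y≠0 z≠0) ⟨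
      toℚ x + toℚ (y +ꟳ z)       ≈⟨ toℚ-+ꟳ x (y +ꟳ z) x≠0 y+z≠0 ⟨
      toℚ (x +ꟳ (y +ꟳ z))        ∎)
    where
    x+y≠0 = NonzeroDen-+ꟳ x y x≠0 y≠0
    y+z≠0 = NonzeroDen-+ꟳ y z y≠0 z≠0

  ·ꟳ-assoc : ∀ m x y z → NonzeroDen x → NonzeroDen y → NonzeroDen z →
             Close m ((x ·ꟳ y) ·ꟳ z) (x ·ꟳ (y ·ꟳ z))
  ·ꟳ-assoc m x y z x≠0 y≠0 z≠0 = ≃⇒Close m _ _
    (NonzeroDen-·ꟳ (x ·ꟳ y) z x·y≠0 z≠0) (NonzeroDen-·ꟳ x (y ·ꟳ z) x≠0 y·z≠0) (begin
      toℚ ((x ·ꟳ y) ·ꟳ z)        ≈⟨ toℚ-·ꟳ (x ·ꟳ y) z x·y≠0 z≠0 ⟩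
      toℚ (x ·ꟳ y) * toℚ z       ≈⟨ ℚₚ.*-congʳ {toℚ z} (toℚ-·ꟳ x y x≠0 y≠0) ⟩
      (toℚ x * toℚ y) * toℚ z    ≈⟨ ℚₚ.*-assoc (toℚ x) (toℚ y) (toℚ z) ⟩
      toℚ x * (toℚ y * toℚ z)    ≈⟨ ℚₚ.*-congˡ {toℚ x} (toℚ-·ꟳ y z y≠0 z≠0) ⟨
      toℚ x * toℚ (y ·ꟳ z)       ≈⟨ toℚ-·ꟳ x (y ·ꟳ z) x≠0 y·z≠0 ⟨
      toℚ (x ·ꟳ (y ·ꟳ z))        ∎)
    where
    x·y≠0 = NonzeroDen-·ꟳ x y x≠0 y≠0
    y·z≠0 = NonzeroDen-·ꟳ y z y≠0 z≠0

  ·ꟳ-distribˡ-+ꟳ : ∀ m x y z → NonzeroDen x → NonzeroDen y → NonzeroDen z →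
                   Close m (x ·ꟳ (y +ꟳ z)) ((x ·ꟳ y) +ꟳ (x ·ꟳ z))
  ·ꟳ-distribˡ-+ꟳ m x y z x≠0 y≠0 z≠0 = ≃⇒Close m _ _
    (NonzeroDen-·ꟳ x (y +ꟳ z) x≠0 y+z≠0) (NonzeroDen-+ꟳ (x ·ꟳ y) (x ·ꟳ z) x·y≠0 x·z≠0) (begin
      toℚ (x ·ꟳ (y +ꟳ z))                ≈⟨ toℚ-·ꟳ x (y +ꟳ z) x≠0 y+z≠0 ⟩
      toℚ x * toℚ (y +ꟳ z)               ≈⟨ ℚₚ.*-congˡ {toℚ x} (toℚ-+ꟳ y z y≠0 z≠0) ⟩
      toℚ x * (toℚ y + toℚ z)            ≈⟨ ℚₚ.*-distribˡ-+ (toℚ x) (toℚ y) (toℚ z) ⟩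
      toℚ x * toℚ y + toℚ x * toℚ z      ≈⟨ ℚₚ.+-cong (toℚ-·ꟳ x y x≠0 y≠0) (toℚ-·ꟳ x z x≠0 z≠0) ⟨
      toℚ (x ·ꟳ y) + toℚ (x ·ꟳ z)        ≈⟨ toℚ-+ꟳ (x ·ꟳ y) (x ·ꟳ z) x·y≠0 x·z≠0 ⟨
      toℚ ((x ·ꟳ y) +ꟳ (x ·ꟳ z))         ∎)
    where
    y+z≠0 = NonzeroDen-+ꟳ y z y≠0 z≠0
    x·y≠0 = NonzeroDen-·ꟳ x y x≠0 y≠0
    x·z≠0 = NonzeroDen-·ꟳ x z x≠0 z≠0

  +ꟳ-comm : ∀ m x y → NonzeroDen x → NonzeroDen y → Close m (x +ꟳ y) (y +ꟳ x)
  +ꟳ-comm m x y x≠0 y≠0 = ≃⇒Close m _ _ (NonzeroDen-+ꟳ x y x≠0 y≠0) (NonzeroDen-+ꟳ y x y≠0 x≠0) (begin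
    toℚ (x +ꟳ y)     ≈⟨ toℚ-+ꟳ x y x≠0 y≠0 ⟩
    toℚ x + toℚ y    ≈⟨ ℚₚ.+-comm (toℚ x) (toℚ y) ⟩
    toℚ y + toℚ x    ≈⟨ toℚ-+ꟳ y x y≠0 x≠0 ⟨
    toℚ (y +ꟳ x)     ∎)

  ·ꟳ-comm : ∀ m x y → NonzeroDen x → NonzeroDen y → Close m (x ·ꟳ y) (y ·ꟳ x)
  ·ꟳ-comm m x y x≠0 y≠0 = ≃⇒Close m _ _ (NonzeroDen-·ꟳ x y x≠0 y≠0) (NonzeroDen-·ꟳ y x y≠0 x≠0) (begin
    toℚ (x ·ꟳ y)     ≈⟨ toℚ-·ꟳ x y x≠0 y≠0 ⟩
    toℚ x * toℚ y    ≈⟨ ℚₚ.*-comm (toℚ x) (toℚ y) ⟩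
    toℚ y * toℚ x    ≈⟨ toℚ-·ꟳ y x y≠0 x≠0 ⟨
    toℚ (y ·ꟳ x)     ∎)

  +ꟳ-identityʳ : ∀ m x → NonzeroDen x → Close m (x +ꟳ 0ꟳ) x
  +ꟳ-identityʳ m x x≠0 = ≃⇒Close m _ _ (NonzeroDen-+ꟳ x 0ꟳ x≠0 NonzeroDen-0ꟳ) x≠0 (begin
    toℚ (x +ꟳ 0ꟳ)      ≈⟨ toℚ-+ꟳ x 0ꟳ x≠0 NonzeroDen-0ꟳ ⟩
    toℚ x + toℚ 0ꟳ     ≈⟨ ℚₚ.+-congʳ (toℚ x) toℚ-0ꟳ ⟩
    toℚ x + 0ℚᵘ        ≈⟨ ℚₚ.+-identityʳ (toℚ x) ⟩
    toℚ x              ∎)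

  ·ꟳ-identityʳ : ∀ m x → NonzeroDen x → Close m (x ·ꟳ 1ꟳ) x
  ·ꟳ-identityʳ m x x≠0 = ≃⇒Close m _ _ (NonzeroDen-·ꟳ x 1ꟳ x≠0 NonzeroDen-1ꟳ) x≠0 (begin
    toℚ (x ·ꟳ 1ꟳ)      ≈⟨ toℚ-·ꟳ x 1ꟳ x≠0 NonzeroDen-1ꟳ ⟩
    toℚ x * toℚ 1ꟳ     ≈⟨ ℚₚ.*-congˡ {toℚ x} toℚ-1ꟳ ⟩
    toℚ x * 1ℚᵘ        ≈⟨ ℚₚ.*-identityʳ (toℚ x) ⟩
    toℚ x              ∎)

  +ꟳ-inverseʳ : ∀ m x → NonzeroDen x → Close m (x +ꟳ neg x) 0ꟳ
  +ꟳ-inverseʳ m x x≠0 = ≃⇒Close m _ _ (NonzeroDen-+ꟳ x (neg x) x≠0 x≠0) NonzeroDen-0ꟳ (begin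
    toℚ (x +ꟳ neg x)      ≈⟨ toℚ-+ꟳ x (neg x) x≠0 x≠0 ⟩
    toℚ x + toℚ (neg x)   ≈⟨ ℚₚ.+-congʳ (toℚ x) (toℚ-neg x x≠0) ⟩
    toℚ x - toℚ x         ≈⟨ ℚₚ.+-inverseʳ (toℚ x) ⟩
    0ℚᵘ                   ≈⟨ toℚ-0ꟳ ⟨
    toℚ 0ꟳ                ∎)

  ¬Close-0ꟳ-1ꟳ : ¬ Close 1 0ꟳ 1ꟳ
  ¬Close-0ꟳ-1ꟳ (_ , 1<1) = ℕₚ.<-irrefl refl 1<1

  Less-irrefl : ∀ m x → NonzeroDen x → ¬ Less m x x
  Less-irrefl m x x≠0 x<x = Lessℚ-irrefl (ℕ→ℚ m) (toℚ x) (fromLess m x x x≠0 x≠0 ℚₚ.≃-refl x<x)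

  Less-trans : ∀ m₁ m₂ x y z → NonzeroDen x → NonzeroDen y → NonzeroDen z →
               Less m₁ x y → Less m₂ y z → Less m₁ x z
  Less-trans m₁ m₂ x y z x≠0 y≠0 z≠0 x<y y<z = toLess m₁ x z x≠0 z≠0 ℚₚ.≃-refl ℚₚ.≃-refl ℚₚ.≃-refl
    (Lessℚ-trans (ℕ→ℚ m₁) (ℕ→ℚ m₂) (toℚ x) (toℚ y) (toℚ z) (ℕ→ℚ-nonNeg m₁) (ℕ→ℚ-nonNeg m₂)
      (fromLess m₁ x y x≠0 y≠0 ℚₚ.≃-refl x<y) (fromLess m₂ y z y≠0 z≠0 ℚₚ.≃-refl y<z))

  Less-+ꟳʳ : ∀ m x y z → NonzeroDen x → NonzeroDen y → NonzeroDen z → Less m x y → Less m (x +ꟳ z) (y +ꟳ z)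
  Less-+ꟳʳ m x y z x≠0 y≠0 z≠0 x<y =
    toLess m (x +ꟳ z) (y +ꟳ z) (NonzeroDen-+ꟳ x z x≠0 z≠0) (NonzeroDen-+ꟳ y z y≠0 z≠0)
      ℚₚ.≃-refl (toℚ-+ꟳ x z x≠0 z≠0) (toℚ-+ꟳ y z y≠0 z≠0)
      (Lessℚ-+ʳ (ℕ→ℚ m) (toℚ x) (toℚ y) (toℚ z) (fromLess m x y x≠0 y≠0 ℚₚ.≃-refl x<y))

  Less-resp-Close : ∀ m x y x' y' → NonzeroDen x → NonzeroDen y → NonzeroDen x' → NonzeroDen y' →
                    Less m x y → Close (fourfold m) x x' → Close (fourfold m) y y' → Less (fourfold m) x' y'
  Less-resp-Close m x y x' y' x≠0 y≠0 x'≠0 y'≠0 x<y x≈x' y≈y' =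
    toLess (fourfold m) x' y' x'≠0 y'≠0 (ℚₚ.≃-sym (ℕ→ℚ-fourfold m)) ℚₚ.≃-refl ℚₚ.≃-refl
      (Lessℚ-resp-Closeℚ (ℕ→ℚ m) (toℚ x) (toℚ y) (toℚ x') (toℚ y') (fromLess m x y x≠0 y≠0 ℚₚ.≃-refl x<y)
        (fromClose (fourfold m) x x' x≠0 x'≠0 (ℕ→ℚ-fourfold m) x≈x')
        (fromClose (fourfold m) y y' y≠0 y'≠0 (ℕ→ℚ-fourfold m) y≈y'))

  ≮-Less : ∀ m a b a' b' → NonzeroDen a → NonzeroDen b → NonzeroDen a' → NonzeroDen b' →
           ¬ (scale m a <ꟳ (1ꟳ +ꟳ scale m b)) → Close (fourfold m) a a' → Close (fourfold m) b b' →
           Less (fourfold m) b' a'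
  ≮-Less m a b a' b' a≠0 b≠0 a'≠0 b'≠0 a≮ a≈a' b≈b' =
    toLess (fourfold m) b' a' b'≠0 a'≠0 (ℚₚ.≃-sym (ℕ→ℚ-fourfold m)) ℚₚ.≃-refl ℚₚ.≃-refl
      (≮-Lessℚ (ℕ→ℚ m) (toℚ a) (toℚ b) (toℚ a') (toℚ b')
        (λ h → a≮ (Equivalence.from (scale<1ꟳ+scale⇔ m a b a≠0 b≠0) h))
        (proj₁ (fromClose (fourfold m) a a' a≠0 a'≠0 (ℕ→ℚ-fourfold m) a≈a'))
        (proj₂ (fromClose (fourfold m) b b' b≠0 b'≠0 (ℕ→ℚ-fourfold m) b≈b')))

  Less-0-·ꟳ : ∀ m₁ m₂ x y → NonzeroDen x → NonzeroDen y → Less m₁ 0ꟳ x → Less m₂ 0ꟳ y →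
              Less (m₁ ℕ.* m₂) 0ꟳ (x ·ꟳ y)
  Less-0-·ꟳ m₁ m₂ x y x≠0 y≠0 0<x 0<y =
    toLess (m₁ ℕ.* m₂) 0ꟳ (x ·ꟳ y) NonzeroDen-0ꟳ (NonzeroDen-·ꟳ x y x≠0 y≠0)
      (ℚₚ.≃-sym (ℕ→ℚ-* m₁ m₂)) toℚ-0ꟳ (toℚ-·ꟳ x y x≠0 y≠0)
      (Lessℚ-0-* (ℕ→ℚ m₁) (ℕ→ℚ m₂) (toℚ x) (toℚ y)
        (fromLess m₁ 0ꟳ x NonzeroDen-0ꟳ x≠0 toℚ-0ꟳ 0<x) (fromLess m₂ 0ꟳ y NonzeroDen-0ꟳ y≠0 toℚ-0ꟳ 0<y))
  ∣toℚ∣+1≤height : ∀ x → NonzeroDen x → ∣ toℚ x ∣ + 1ℚᵘ ℚ.≤ ℕ→ℚ (height x)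
  ∣toℚ∣+1≤height ((p , q) , zero)  x≠0 = ⊥-elim (x≠0 refl)
  ∣toℚ∣+1≤height ((p , q) , suc b) _   =
    ℚₚ.≤-respʳ-≃ (ℚₚ.≃-sym (ℕ→ℚ-+ (p ℕ.+ q) 1)) (ℚₚ.+-monoˡ-≤ 1ℚᵘ ∣x∣≤p+q)
    where
    ∣x∣≤p+q : ∣ toℚ ((p , q) , suc b) ∣ ℚ.≤ ℕ→ℚ (p ℕ.+ q)
    ∣x∣≤p+q = *≤* (subst₂ ℤ._≤_ (sym (ℤₚ.*-identityʳ _)) (ℤₚ.pos-* (p ℕ.+ q) (suc b))
                    (ℤ.+≤+ (ℕₚ.≤-trans (ℤₚ.∣i-j∣≤∣i∣+∣j∣ (+ p) (+ q)) (ℕₚ.m≤m*n (p ℕ.+ q) (suc b)))))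

  Close-·ꟳ : ∀ m x x' y y' x₀ y₀ → NonzeroDen x → NonzeroDen x' → NonzeroDen y → NonzeroDen y' →
             NonzeroDen x₀ → NonzeroDen y₀ → Close 1 x x₀ → Close 1 y' y₀ →
             Close (productModulus m x₀ y₀) x x' → Close (productModulus m x₀ y₀) y y' →
             Close m (x ·ꟳ y) (x' ·ꟳ y')
  Close-·ꟳ m x x' y y' x₀ y₀ x≠0 x'≠0 y≠0 y'≠0 x₀≠0 y₀≠0 x≈x₀ y'≈y₀ x≈x' y≈y' =
    toClose m (x ·ꟳ y) (x' ·ꟳ y') (NonzeroDen-·ꟳ x y x≠0 y≠0) (NonzeroDen-·ꟳ x' y' x'≠0 y'≠0)
      (toℚ-·ꟳ x y x≠0 y≠0) (toℚ-·ꟳ x' y' x'≠0 y'≠0)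
      (∣-∣<1⇒Closeℚ (ℕ→ℚ m) (toℚ x * toℚ y) (toℚ x' * toℚ y') (ℕ→ℚ-nonNeg m)
        (∣-∣<1-* (ℕ→ℚ m) (ℕ→ℚ H) (toℚ x) (toℚ x') (toℚ y) (toℚ y') (ℕ→ℚ-nonNeg m)
          (bounded x x₀ x≠0 x₀≠0 x≈x₀ (ℕₚ.m≤m+n (height x₀) (height y₀)))
          (bounded y' y₀ y'≠0 y₀≠0 y'≈y₀ (ℕₚ.m≤n+m (height y₀) (height x₀)))
          (precise x x' x≠0 x'≠0 x≈x') (precise y y' y≠0 y'≠0 y≈y')))
    where
    H = height x₀ ℕ.+ height y₀
    K = productModulus m x₀ y₀
    K≃ : ℕ→ℚ K ≃ (ℕ→ℚ m * ℕ→ℚ H) + (ℕ→ℚ m * ℕ→ℚ H)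
    K≃ = ℚₚ.≃-trans (ℕ→ℚ-+ (m ℕ.* H) (m ℕ.* H)) (ℚₚ.+-cong (ℕ→ℚ-* m H) (ℕ→ℚ-* m H))
    precise : ∀ u v → NonzeroDen u → NonzeroDen v → Close K u v →
              ((ℕ→ℚ m * ℕ→ℚ H) + (ℕ→ℚ m * ℕ→ℚ H)) * ∣ toℚ u - toℚ v ∣ ℚ.< 1ℚᵘ
    precise u v u≠0 v≠0 u≈v = Closeℚ⇒∣-∣<1 _ (toℚ u) (toℚ v)
      (+-nonNeg (*-nonNeg (ℕ→ℚ-nonNeg m) (ℕ→ℚ-nonNeg H)) (*-nonNeg (ℕ→ℚ-nonNeg m) (ℕ→ℚ-nonNeg H)))
      (fromClose K u v u≠0 v≠0 K≃ u≈v)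
    bounded : ∀ u u₀ → NonzeroDen u → NonzeroDen u₀ → Close 1 u u₀ → height u₀ ℕ.≤ H → ∣ toℚ u ∣ ℚ.≤ ℕ→ℚ H
    bounded u u₀ u≠0 u₀≠0 u≈u₀ h≤H = ℚₚ.≤-trans
      (∣X∣≤∣X₀∣+1 (toℚ u) (toℚ u₀)
        (Closeℚ⇒∣-∣<1 1ℚᵘ (toℚ u) (toℚ u₀) (ℕ→ℚ-nonNeg 1) (fromClose 1 u u₀ u≠0 u₀≠0 ℚₚ.≃-refl u≈u₀)))
      (ℚₚ.≤-trans (∣toℚ∣+1≤height u₀ u₀≠0) (ℕ→ℚ-mono-≤ h≤H))

  Apart⇔Apartℚ : ∀ c a → NonzeroDen a → Apart c a ⇔ Apartℚ (ℕ→ℚ c) (toℚ a)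
  Apart⇔Apartℚ c a a≠0 = mk⇔
    (λ { (inj₁ h) → inj₁ (Equivalence.to (1<scale⇔ a a≠0 ℚₚ.≃-refl) h)
       ; (inj₂ h) → inj₂ (Equivalence.to (1<scale⇔ (neg a) a≠0 (toℚ-neg a a≠0)) h) })
    (λ { (inj₁ h) → inj₁ (Equivalence.from (1<scale⇔ a a≠0 ℚₚ.≃-refl) h)
       ; (inj₂ h) → inj₂ (Equivalence.from (1<scale⇔ (neg a) a≠0 (toℚ-neg a a≠0)) h) })
    where
    1<scale⇔ : ∀ b {B} → NonzeroDen b → toℚ b ≃ B → 1ꟳ <ꟳ scale c b ⇔ 1ℚᵘ ℚ.< ℕ→ℚ c * B
    1<scale⇔ b b≠0 b≃B = <ꟳ⇔<-≃ 1ꟳ (scale c b) NonzeroDen-1ꟳ b≠0 toℚ-1ꟳ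
      (ℚₚ.≃-trans (toℚ-scale c b b≠0) (ℚₚ.*-congˡ {ℕ→ℚ c} b≃B))

  ¬Close-0⇒Apart : ∀ m a b → NonzeroDen a → NonzeroDen b → ¬ Close m a 0ꟳ → Close (m ℕ.+ m) b a →
                   Apart (m ℕ.+ m) b
  ¬Close-0⇒Apart m a b a≠0 b≠0 a≉0 b≈a = Equivalence.from (Apart⇔Apartℚ (m ℕ.+ m) b b≠0)
    (Apartℚ-cong (ℚₚ.≃-sym (ℕ→ℚ-double m))
      (¬Closeℚ-0⇒Apartℚ (ℕ→ℚ m) (toℚ a) (toℚ b)
        (λ h → a≉0 (toClose m a 0ꟳ a≠0 NonzeroDen-0ꟳ ℚₚ.≃-refl toℚ-0ꟳ h))
        (fromClose (m ℕ.+ m) b a b≠0 a≠0 (ℕ→ℚ-double m) b≈a)))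

  NonzeroDen-inverse : ∀ a r → NonzeroDen a → IsInverse a r → NonzeroDen r
  NonzeroDen-inverse _ _ _ (inj₁ (_ , _ , _ , refl)) ()
  NonzeroDen-inverse ((p , q) , b) _ _ (inj₂ (inj₁ (q<p , _ , _ , q+0≡p))) refl =
    ℕₚ.<-irrefl (trans (sym (ℕₚ.+-identityʳ q)) q+0≡p) q<p
  NonzeroDen-inverse ((p , q) , b) _ _ (inj₂ (inj₂ (p<q , _ , _ , p+0≡q))) refl =
    ℕₚ.<-irrefl (trans (sym (ℕₚ.+-identityʳ p)) p+0≡q) p<q

  inverse-*-≃1 : ∀ c a r → NonzeroDen a → IsInverse a r → Apart c a → toℚ r * toℚ a ≃ 1ℚᵘ
  inverse-*-≃1 c ((p , q) , zero) r a≠0 _ _ = ⊥-elim (a≠0 refl)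
  inverse-*-≃1 c ((p , .p) , suc b) _ a≠0 (inj₁ (refl , _)) a#0 =
    ⊥-elim (not-apart (Equivalence.to (Apart⇔Apartℚ c _ a≠0) a#0))
    where
    a≃0 : toℚ ((p , p) , suc b) ≃ 0ℚᵘ
    a≃0 = *≡* (p-p (+ p) (+ suc b))
      where
      p-p : ∀ P B → (P ℤ.- P) ℤ.* + 1 ≡ + 0 ℤ.* B
      p-p = solve-∀
    c·0≃0 : ∀ {X} → X ≃ 0ℚᵘ → ℕ→ℚ c * X ≃ 0ℚᵘ
    c·0≃0 X≃0 = ℚₚ.≃-trans (ℚₚ.*-congˡ {ℕ→ℚ c} X≃0) (ℚₚ.*-zeroʳ (ℕ→ℚ c))
    not-apart : ¬ Apartℚ (ℕ→ℚ c) (toℚ ((p , p) , suc b))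
    not-apart (inj₁ h) = ℚₚ.<-asym 0<1 (<-resp₂-≃ ℚₚ.≃-refl (c·0≃0 a≃0) h)
    not-apart (inj₂ h) = ℚₚ.<-asym 0<1 (<-resp₂-≃ ℚₚ.≃-refl (c·0≃0 (ℚₚ.-‿cong a≃0)) h)
  inverse-*-≃1 c ((.(q ℕ.+ 0) , q) , suc b) (_ , zero) _ (inj₂ (inj₁ (q<q+0 , _ , _ , refl))) _ =
    ⊥-elim (ℕₚ.<-irrefl (sym (ℕₚ.+-identityʳ q)) q<q+0)
  inverse-*-≃1 c ((.(q ℕ.+ suc d) , q) , suc b) ((.(suc b) , .0) , suc d) _ (inj₂ (inj₁ (_ , refl , refl , refl))) _ =
    *≡* (trans (cong (λ t → ((+ suc b ℤ.- + 0) ℤ.* (t ℤ.- + q)) ℤ.* + 1) (ℤₚ.pos-+ q (suc d)))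
          (trans (cancel (+ suc b) (+ suc d) (+ q)) (cong (+ 1 ℤ.*_) (sym (ℤₚ.pos-* (suc d) (suc b))))))
    where
    cancel : ∀ B D q → ((B ℤ.- + 0) ℤ.* ((q ℤ.+ D) ℤ.- q)) ℤ.* + 1 ≡ + 1 ℤ.* (D ℤ.* B)
    cancel = solve-∀
  inverse-*-≃1 c ((p , .(p ℕ.+ 0)) , suc b) (_ , zero) _ (inj₂ (inj₂ (p<p+0 , _ , _ , refl))) _ =
    ⊥-elim (ℕₚ.<-irrefl (sym (ℕₚ.+-identityʳ p)) p<p+0)
  inverse-*-≃1 c ((p , .(p ℕ.+ suc d)) , suc b) ((.0 , .(suc b)) , suc d) _ (inj₂ (inj₂ (_ , refl , refl , refl))) _ =
    *≡* (trans (cong (λ t → ((+ 0 ℤ.- + suc b) ℤ.* (+ p ℤ.- t)) ℤ.* + 1) (ℤₚ.pos-+ p (suc d)))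
          (trans (cancel (+ suc b) (+ suc d) (+ p)) (cong (+ 1 ℤ.*_) (sym (ℤₚ.pos-* (suc d) (suc b))))))
    where
    cancel : ∀ B D p → ((+ 0 ℤ.- B) ℤ.* (p ℤ.- (p ℤ.+ D))) ℤ.* + 1 ≡ + 1 ℤ.* (D ℤ.* B)
    cancel = solve-∀

  Close-inverse : ∀ m c a b r s → NonzeroDen a → NonzeroDen b → IsInverse a r → IsInverse b s →
                  Apart c a → Apart c b → Close ((c ℕ.* c) ℕ.* m) a b → Close m r s
  Close-inverse m c a b r s a≠0 b≠0 r⁻¹ s⁻¹ a#0 b#0 a≈b =
    toClose m r s r≠0 s≠0 ℚₚ.≃-refl ℚₚ.≃-refl (∣-∣<1⇒Closeℚ (ℕ→ℚ m) (toℚ r) (toℚ s) (ℕ→ℚ-nonNeg m)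
      (∣-∣<1-inverse (ℕ→ℚ m) (ℕ→ℚ c) (toℚ a) (toℚ b) (toℚ r) (toℚ s) (ℕ→ℚ-nonNeg m)
        (Apartℚ⇒1<c∣X∣ (ℕ→ℚ c) (toℚ a) (ℕ→ℚ-nonNeg c) (Equivalence.to (Apart⇔Apartℚ c a a≠0) a#0))
        (Apartℚ⇒1<c∣X∣ (ℕ→ℚ c) (toℚ b) (ℕ→ℚ-nonNeg c) (Equivalence.to (Apart⇔Apartℚ c b b≠0) b#0))
        (inverse-*-≃1 c a r a≠0 r⁻¹ a#0) (inverse-*-≃1 c b s b≠0 s⁻¹ b#0)
        (Closeℚ⇒∣-∣<1 _ (toℚ a) (toℚ b) (ℚₚ.≤-respʳ-≃ K≃ (ℕ→ℚ-nonNeg K)) (fromClose K a b a≠0 b≠0 K≃ a≈b))))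
    where
    r≠0 = NonzeroDen-inverse a r a≠0 r⁻¹
    s≠0 = NonzeroDen-inverse b s b≠0 s⁻¹
    K = (c ℕ.* c) ℕ.* m
    K≃ : ℕ→ℚ K ≃ (ℕ→ℚ c * ℕ→ℚ c) * ℕ→ℚ m
    K≃ = ℚₚ.≃-trans (ℕ→ℚ-* (c ℕ.* c) m) (ℚₚ.*-congʳ {ℕ→ℚ m} (ℕ→ℚ-* c c))

  ·ꟳ-inverseʳ : ∀ m c a r → NonzeroDen a → IsInverse a r → Apart c a → Close m (a ·ꟳ r) 1ꟳ
  ·ꟳ-inverseʳ m c a r a≠0 r⁻¹ a#0 = ≃⇒Close m (a ·ꟳ r) 1ꟳ (NonzeroDen-·ꟳ a r a≠0 r≠0) NonzeroDen-1ꟳ (begin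
    toℚ (a ·ꟳ r)     ≈⟨ toℚ-·ꟳ a r a≠0 r≠0 ⟩
    toℚ a * toℚ r    ≈⟨ ℚₚ.*-comm (toℚ a) (toℚ r) ⟩
    toℚ r * toℚ a    ≈⟨ inverse-*-≃1 c a r a≠0 r⁻¹ a#0 ⟩
    1ℚᵘ              ≈⟨ toℚ-1ꟳ ⟨
    toℚ 1ꟳ           ∎)
    where
    r≠0 = NonzeroDen-inverse a r a≠0 r⁻¹

module InModel (M : Structure) (M⊨Th : ModelOfThN M) where
  open Structure M using (Carrier; _+_; _·_; _<_) renaming (zero to 0ᴹ; one to 1ᴹ)
  open KM M
  open FracOps M

  infixr 5 _∷ꟳ_
  _∷ꟳ_ : ∀ {n} → Frac → Vector Carrier n → Vector Carrier (3 ℕ.+ n)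
  ((p , q) , b) ∷ꟳ e = p ∷ q ∷ b ∷ e

  private
    fracAt : ∀ {n} → Vector ℕ n → Fin n → Fin n → Fin n → KM.Frac ℕ-str
    fracAt e i j k = (e i , e j) , e k

    -- Variable layout of the transferred formulas: a scalar at index 0, then fractions X₁, X₂, …
    μ : ∀ {n} → Term (suc n)
    μ = var zero

    X₁ : ∀ {n} → FracTerm (4 ℕ.+ n)
    X₁ = fracVar (# 1) (# 2) (# 3)
    X₂ : ∀ {n} → FracTerm (7 ℕ.+ n)
    X₂ = fracVar (# 4) (# 5) (# 6)
    X₃ : ∀ {n} → FracTerm (10 ℕ.+ n)
    X₃ = fracVar (# 7) (# 8) (# 9)
    X₄ : ∀ {n} → FracTerm (13 ℕ.+ n)
    X₄ = fracVar (# 10) (# 11) (# 12)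
    X₅ : ∀ {n} → FracTerm (16 ℕ.+ n)
    X₅ = fracVar (# 13) (# 14) (# 15)
    X₆ : ∀ {n} → FracTerm (19 ℕ.+ n)
    X₆ = fracVar (# 16) (# 17) (# 18)

    frac₁ : ∀ {n} → Vector ℕ (4 ℕ.+ n) → KM.Frac ℕ-str
    frac₁ e = fracAt e (# 1) (# 2) (# 3)
    frac₂ : ∀ {n} → Vector ℕ (7 ℕ.+ n) → KM.Frac ℕ-str
    frac₂ e = fracAt e (# 4) (# 5) (# 6)
    frac₃ : ∀ {n} → Vector ℕ (10 ℕ.+ n) → KM.Frac ℕ-str
    frac₃ e = fracAt e (# 7) (# 8) (# 9)
    frac₄ : ∀ {n} → Vector ℕ (13 ℕ.+ n) → KM.Frac ℕ-str
    frac₄ e = fracAt e (# 10) (# 11) (# 12)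
    frac₅ : ∀ {n} → Vector ℕ (16 ℕ.+ n) → KM.Frac ℕ-str
    frac₅ e = fracAt e (# 13) (# 14) (# 15)
    frac₆ : ∀ {n} → Vector ℕ (19 ℕ.+ n) → KM.Frac ℕ-str
    frac₆ e = fracAt e (# 16) (# 17) (# 18)

    valid : ∀ {n} (φ : Formula n) → (∀ e → Sat ℕ-str φ e) → ∀ e → Sat M φ e
    valid = transfer M⊨Th

  1≢0 : ¬ 1ᴹ ≡ 0ᴹ
  1≢0 = valid ((𝟙 ≐ 𝟘) ⇒ ⊥f) (λ _ ()) []

  0<1 : 0ᴹ < 1ᴹ
  0<1 = valid (𝟘 ≺ 𝟙) (λ _ → ℕ.s≤s ℕ.z≤n) []

  n<n+1 : ∀ n → n < (n + 1ᴹ)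
  n<n+1 n = valid (var (# 0) ≺ (var (# 0) ⊕ 𝟙)) (λ e → ℕₚ.m<m+n (e (# 0)) (ℕ.s≤s ℕ.z≤n)) (n ∷ [])

  +-<ˡ : ∀ {a b k} → (a + b) < k → a < k
  +-<ˡ {a} {b} {k} = valid (((var (# 0) ⊕ var (# 1)) ≺ var (# 2)) ⇒ (var (# 0) ≺ var (# 2)))
    (λ e → ℕₚ.≤-<-trans (ℕₚ.m≤m+n (e (# 0)) (e (# 1)))) (a ∷ b ∷ k ∷ [])

  +-<ʳ : ∀ {a b k} → (a + b) < k → b < k
  +-<ʳ {a} {b} {k} = valid (((var (# 0) ⊕ var (# 1)) ≺ var (# 2)) ⇒ (var (# 1) ≺ var (# 2)))
    (λ e → ℕₚ.≤-<-trans (ℕₚ.m≤n+m (e (# 1)) (e (# 0)))) (a ∷ b ∷ k ∷ [])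

  double-pos : ∀ m → 0ᴹ < m → 0ᴹ < (m + m)
  double-pos m = valid ((𝟘 ≺ var (# 0)) ⇒ (𝟘 ≺ (var (# 0) ⊕ var (# 0))))
    (λ e 0<m → ℕₚ.<-≤-trans 0<m (ℕₚ.m≤m+n (e (# 0)) (e (# 0)))) (m ∷ [])

  fourfold-pos : ∀ m → 0ᴹ < m → 0ᴹ < fourfold m
  fourfold-pos m 0<m = double-pos (m + m) (double-pos m 0<m)

  *-pos : ∀ a b → 0ᴹ < a → 0ᴹ < b → 0ᴹ < (a · b)
  *-pos a b = valid ((𝟘 ≺ var (# 0)) ⇒ ((𝟘 ≺ var (# 1)) ⇒ (𝟘 ≺ (var (# 0) ⊗ var (# 1)))))
    (λ e → pos (e (# 0)) (e (# 1))) (a ∷ b ∷ [])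
    where
    pos : ∀ a b → 0 ℕ.< a → 0 ℕ.< b → 0 ℕ.< a ℕ.* b
    pos (suc a) (suc b) _ _ = ℕ.s≤s ℕ.z≤n

  productModulus-pos : ∀ m x₀ y₀ → 0ᴹ < m → 0ᴹ < productModulus m x₀ y₀
  productModulus-pos m x₀ y₀ 0<m = double-pos _ (*-pos m _ 0<m 0<H)
    where
    0<H : 0ᴹ < (height x₀ + height y₀)
    0<H = valid (𝟘 ≺ (heightᵗ (fracVar (# 0) (# 1) (# 2)) ⊕ heightᵗ (fracVar (# 3) (# 4) (# 5))))
      (λ e → ℕₚ.<-≤-trans (ℕₚ.n<1+n 0) (ℕₚ.≤-trans (ℕₚ.m≤n+m 1 (e (# 0) ℕ.+ e (# 1))) (ℕₚ.m≤m+n _ _)))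
      (x₀ ∷ꟳ y₀ ∷ꟳ [])

  *-≢0 : ∀ b d → ¬ b ≡ 0ᴹ → ¬ d ≡ 0ᴹ → ¬ (b · d) ≡ 0ᴹ
  *-≢0 b d = valid (((var (# 0) ≐ 𝟘) ⇒ ⊥f) ⇒ (((var (# 1) ≐ 𝟘) ⇒ ⊥f) ⇒ (((var (# 0) ⊗ var (# 1)) ≐ 𝟘) ⇒ ⊥f)))
    (λ e → ≢0 (e (# 0)) (e (# 1))) (b ∷ d ∷ [])
    where
    ≢0 : ∀ b d → ¬ b ≡ 0 → ¬ d ≡ 0 → ¬ b ℕ.* d ≡ 0
    ≢0 zero    d       b≢0 _   _ = b≢0 refl
    ≢0 (suc b) zero    _   d≢0 _ = d≢0 refl
    ≢0 (suc b) (suc d) _   _   ()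

  trichotomy : ∀ p q → (p < q) ⊎ (p ≡ q) ⊎ (q < p)
  trichotomy p q = valid ((var (# 0) ≺ var (# 1)) ∨f ((var (# 0) ≐ var (# 1)) ∨f (var (# 1) ≺ var (# 0))))
    (λ e → tri (ℕₚ.<-cmp (e (# 0)) (e (# 1)))) (p ∷ q ∷ [])
    where
    tri : ∀ {p q : ℕ} → Tri (p ℕ.< q) (p ≡ q) (q ℕ.< p) → (p ℕ.< q) ⊎ (p ≡ q) ⊎ (q ℕ.< p)
    tri (tri< p<q _ _) = inj₁ p<q
    tri (tri≈ _ p≡q _) = inj₂ (inj₁ p≡q)
    tri (tri> _ _ q<p) = inj₂ (inj₂ q<p)

  difference : ∀ {p q} → q < p → Σ Carrier λ d → (q + d) ≡ p
  difference {p} {q} = valid ((var (# 1) ≺ var (# 0)) ⇒ ∃f ((var (# 2) ⊕ var (# 0)) ≐ var (# 1)))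
    (λ e q<p → e (# 0) ℕ.∸ e (# 1) , ℕₚ.m+[n∸m]≡n (ℕₚ.<⇒≤ q<p)) (p ∷ q ∷ [])

  +-cancelˡ : ∀ q r r' → (q + r) ≡ (q + r') → r ≡ r'
  +-cancelˡ q r r' = valid (((var (# 0) ⊕ var (# 1)) ≐ (var (# 0) ⊕ var (# 2))) ⇒ (var (# 1) ≐ var (# 2)))
    (λ e → ℕₚ.+-cancelˡ-≡ (e (# 0)) (e (# 1)) (e (# 2))) (q ∷ r ∷ r' ∷ [])

  <-irrefl : ∀ p → ¬ p < p
  <-irrefl p = valid ((var (# 0) ≺ var (# 0)) ⇒ ⊥f) (λ e → ℕₚ.<-irrefl refl) (p ∷ [])

  <-asym : ∀ p q → p < q → ¬ q < p
  <-asym p q = valid ((var (# 0) ≺ var (# 1)) ⇒ ((var (# 1) ≺ var (# 0)) ⇒ ⊥f))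
    (λ e → ℕₚ.<-asym) (p ∷ q ∷ [])

  Close-refl : ∀ m x → NonzeroDen x → Close m x x
  Close-refl m x = valid (NonzeroDenᶠ X₁ ⇒ Closeᶠ μ X₁ X₁)
    (λ e → NatFacts.Close-refl (e (# 0)) (frac₁ e)) (m ∷ x ∷ꟳ [])

  Close-trans : ∀ m x y z → NonzeroDen x → NonzeroDen y → NonzeroDen z →
                Close (m + m) x y → Close (m + m) y z → Close m x z
  Close-trans m x y z = valid
    (NonzeroDenᶠ X₁ ⇒ NonzeroDenᶠ X₂ ⇒ NonzeroDenᶠ X₃ ⇒ Closeᶠ (μ ⊕ μ) X₁ X₂ ⇒ Closeᶠ (μ ⊕ μ) X₂ X₃ ⇒ Closeᶠ μ X₁ X₃)
    (λ e → NatFacts.Close-trans (e (# 0)) (frac₁ e) (frac₂ e) (frac₃ e)) (m ∷ x ∷ꟳ y ∷ꟳ z ∷ꟳ [])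

  Close-+ꟳ : ∀ m x x' y y' → NonzeroDen x → NonzeroDen x' → NonzeroDen y → NonzeroDen y' →
             Close (m + m) x x' → Close (m + m) y y' → Close m (x +ꟳ y) (x' +ꟳ y')
  Close-+ꟳ m x x' y y' = valid
    (NonzeroDenᶠ X₁ ⇒ NonzeroDenᶠ X₂ ⇒ NonzeroDenᶠ X₃ ⇒ NonzeroDenᶠ X₄ ⇒
     Closeᶠ (μ ⊕ μ) X₁ X₂ ⇒ Closeᶠ (μ ⊕ μ) X₃ X₄ ⇒ Closeᶠ μ (X₁ +ꟳᵗ X₃) (X₂ +ꟳᵗ X₄))
    (λ e → NatFacts.Close-+ꟳ (e (# 0)) (frac₁ e) (frac₂ e) (frac₃ e) (frac₄ e))
    (m ∷ x ∷ꟳ x' ∷ꟳ y ∷ꟳ y' ∷ꟳ [])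

  Close-·ꟳ : ∀ m x x' y y' x₀ y₀ → NonzeroDen x → NonzeroDen x' → NonzeroDen y → NonzeroDen y' →
             NonzeroDen x₀ → NonzeroDen y₀ → Close 1ᴹ x x₀ → Close 1ᴹ y' y₀ →
             Close (productModulus m x₀ y₀) x x' → Close (productModulus m x₀ y₀) y y' →
             Close m (x ·ꟳ y) (x' ·ꟳ y')
  Close-·ꟳ m x x' y y' x₀ y₀ = valid
    (NonzeroDenᶠ X₁ ⇒ NonzeroDenᶠ X₂ ⇒ NonzeroDenᶠ X₃ ⇒ NonzeroDenᶠ X₄ ⇒ NonzeroDenᶠ X₅ ⇒ NonzeroDenᶠ X₆ ⇒
     Closeᶠ 𝟙 X₁ X₅ ⇒ Closeᶠ 𝟙 X₄ X₆ ⇒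
     Closeᶠ (productModulusᵗ μ X₅ X₆) X₁ X₂ ⇒ Closeᶠ (productModulusᵗ μ X₅ X₆) X₃ X₄ ⇒
     Closeᶠ μ (X₁ ·ꟳᵗ X₃) (X₂ ·ꟳᵗ X₄))
    (λ e → NatFacts.Close-·ꟳ (e (# 0)) (frac₁ e) (frac₂ e) (frac₃ e) (frac₄ e) (frac₅ e) (frac₆ e))
    (m ∷ x ∷ꟳ x' ∷ꟳ y ∷ꟳ y' ∷ꟳ x₀ ∷ꟳ y₀ ∷ꟳ [])

  Close-neg : ∀ m x y → NonzeroDen x → NonzeroDen y → Close m x y → Close m (neg x) (neg y)
  Close-neg m x y = valid
    (NonzeroDenᶠ X₁ ⇒ NonzeroDenᶠ X₂ ⇒ Closeᶠ μ X₁ X₂ ⇒ Closeᶠ μ (negᵗ X₁) (negᵗ X₂))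
    (λ e → NatFacts.Close-neg (e (# 0)) (frac₁ e) (frac₂ e)) (m ∷ x ∷ꟳ y ∷ꟳ [])

  +ꟳ-assoc : ∀ m x y z → NonzeroDen x → NonzeroDen y → NonzeroDen z → Close m ((x +ꟳ y) +ꟳ z) (x +ꟳ (y +ꟳ z))
  +ꟳ-assoc m x y z = valid
    (NonzeroDenᶠ X₁ ⇒ NonzeroDenᶠ X₂ ⇒ NonzeroDenᶠ X₃ ⇒ Closeᶠ μ ((X₁ +ꟳᵗ X₂) +ꟳᵗ X₃) (X₁ +ꟳᵗ (X₂ +ꟳᵗ X₃)))
    (λ e → NatFacts.+ꟳ-assoc (e (# 0)) (frac₁ e) (frac₂ e) (frac₃ e))
    (m ∷ x ∷ꟳ y ∷ꟳ z ∷ꟳ [])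

  ·ꟳ-assoc : ∀ m x y z → NonzeroDen x → NonzeroDen y → NonzeroDen z → Close m ((x ·ꟳ y) ·ꟳ z) (x ·ꟳ (y ·ꟳ z))
  ·ꟳ-assoc m x y z = valid
    (NonzeroDenᶠ X₁ ⇒ NonzeroDenᶠ X₂ ⇒ NonzeroDenᶠ X₃ ⇒ Closeᶠ μ ((X₁ ·ꟳᵗ X₂) ·ꟳᵗ X₃) (X₁ ·ꟳᵗ (X₂ ·ꟳᵗ X₃)))
    (λ e → NatFacts.·ꟳ-assoc (e (# 0)) (frac₁ e) (frac₂ e) (frac₃ e))
    (m ∷ x ∷ꟳ y ∷ꟳ z ∷ꟳ [])

  ·ꟳ-distribˡ-+ꟳ : ∀ m x y z → NonzeroDen x → NonzeroDen y → NonzeroDen z →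
                   Close m (x ·ꟳ (y +ꟳ z)) ((x ·ꟳ y) +ꟳ (x ·ꟳ z))
  ·ꟳ-distribˡ-+ꟳ m x y z = valid
    (NonzeroDenᶠ X₁ ⇒ NonzeroDenᶠ X₂ ⇒ NonzeroDenᶠ X₃ ⇒
     Closeᶠ μ (X₁ ·ꟳᵗ (X₂ +ꟳᵗ X₃)) ((X₁ ·ꟳᵗ X₂) +ꟳᵗ (X₁ ·ꟳᵗ X₃)))
    (λ e → NatFacts.·ꟳ-distribˡ-+ꟳ (e (# 0)) (frac₁ e) (frac₂ e) (frac₃ e))
    (m ∷ x ∷ꟳ y ∷ꟳ z ∷ꟳ [])

  +ꟳ-comm : ∀ m x y → NonzeroDen x → NonzeroDen y → Close m (x +ꟳ y) (y +ꟳ x)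
  +ꟳ-comm m x y = valid (NonzeroDenᶠ X₁ ⇒ NonzeroDenᶠ X₂ ⇒ Closeᶠ μ (X₁ +ꟳᵗ X₂) (X₂ +ꟳᵗ X₁))
    (λ e → NatFacts.+ꟳ-comm (e (# 0)) (frac₁ e) (frac₂ e)) (m ∷ x ∷ꟳ y ∷ꟳ [])

  ·ꟳ-comm : ∀ m x y → NonzeroDen x → NonzeroDen y → Close m (x ·ꟳ y) (y ·ꟳ x)
  ·ꟳ-comm m x y = valid (NonzeroDenᶠ X₁ ⇒ NonzeroDenᶠ X₂ ⇒ Closeᶠ μ (X₁ ·ꟳᵗ X₂) (X₂ ·ꟳᵗ X₁))
    (λ e → NatFacts.·ꟳ-comm (e (# 0)) (frac₁ e) (frac₂ e)) (m ∷ x ∷ꟳ y ∷ꟳ [])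

  +ꟳ-identityʳ : ∀ m x → NonzeroDen x → Close m (x +ꟳ 0ꟳ) x
  +ꟳ-identityʳ m x = valid (NonzeroDenᶠ X₁ ⇒ Closeᶠ μ (X₁ +ꟳᵗ 0ꟳᵗ) X₁)
    (λ e → NatFacts.+ꟳ-identityʳ (e (# 0)) (frac₁ e)) (m ∷ x ∷ꟳ [])

  ·ꟳ-identityʳ : ∀ m x → NonzeroDen x → Close m (x ·ꟳ 1ꟳ) x
  ·ꟳ-identityʳ m x = valid (NonzeroDenᶠ X₁ ⇒ Closeᶠ μ (X₁ ·ꟳᵗ 1ꟳᵗ) X₁)
    (λ e → NatFacts.·ꟳ-identityʳ (e (# 0)) (frac₁ e)) (m ∷ x ∷ꟳ [])

  +ꟳ-inverseʳ : ∀ m x → NonzeroDen x → Close m (x +ꟳ neg x) 0ꟳ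
  +ꟳ-inverseʳ m x = valid (NonzeroDenᶠ X₁ ⇒ Closeᶠ μ (X₁ +ꟳᵗ negᵗ X₁) 0ꟳᵗ)
    (λ e → NatFacts.+ꟳ-inverseʳ (e (# 0)) (frac₁ e)) (m ∷ x ∷ꟳ [])

  ¬Close-0ꟳ-1ꟳ : ¬ Close 1ᴹ 0ꟳ 1ꟳ
  ¬Close-0ꟳ-1ꟳ = valid (Closeᶠ 𝟙 0ꟳᵗ 1ꟳᵗ ⇒ ⊥f) (λ _ → NatFacts.¬Close-0ꟳ-1ꟳ) []

  Less-irrefl : ∀ m x → NonzeroDen x → ¬ Less m x x
  Less-irrefl m x = valid (NonzeroDenᶠ X₁ ⇒ Lessᶠ μ X₁ X₁ ⇒ ⊥f)
    (λ e → NatFacts.Less-irrefl (e (# 0)) (frac₁ e)) (m ∷ x ∷ꟳ [])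

  Less-trans : ∀ m₁ m₂ x y z → NonzeroDen x → NonzeroDen y → NonzeroDen z →
               Less m₁ x y → Less m₂ y z → Less m₁ x z
  Less-trans m₁ m₂ x y z = valid
    (NonzeroDenᶠ X₁ ⇒ NonzeroDenᶠ X₂ ⇒ NonzeroDenᶠ X₃ ⇒ Lessᶠ μ X₁ X₂ ⇒ Lessᶠ (var (# 10)) X₂ X₃ ⇒ Lessᶠ μ X₁ X₃)
    (λ e → NatFacts.Less-trans (e (# 0)) (e (# 10)) (frac₁ e) (frac₂ e) (frac₃ e))
    (m₁ ∷ x ∷ꟳ y ∷ꟳ z ∷ꟳ m₂ ∷ [])

  Less-+ꟳʳ : ∀ m x y z → NonzeroDen x → NonzeroDen y → NonzeroDen z → Less m x y → Less m (x +ꟳ z) (y +ꟳ z)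
  Less-+ꟳʳ m x y z = valid
    (NonzeroDenᶠ X₁ ⇒ NonzeroDenᶠ X₂ ⇒ NonzeroDenᶠ X₃ ⇒ Lessᶠ μ X₁ X₂ ⇒ Lessᶠ μ (X₁ +ꟳᵗ X₃) (X₂ +ꟳᵗ X₃))
    (λ e → NatFacts.Less-+ꟳʳ (e (# 0)) (frac₁ e) (frac₂ e) (frac₃ e)) (m ∷ x ∷ꟳ y ∷ꟳ z ∷ꟳ [])

  Less-resp-Close : ∀ m x y x' y' → NonzeroDen x → NonzeroDen y → NonzeroDen x' → NonzeroDen y' →
                    Less m x y → Close (fourfold m) x x' → Close (fourfold m) y y' → Less (fourfold m) x' y'
  Less-resp-Close m x y x' y' = valid
    (NonzeroDenᶠ X₁ ⇒ NonzeroDenᶠ X₂ ⇒ NonzeroDenᶠ X₃ ⇒ NonzeroDenᶠ X₄ ⇒ Lessᶠ μ X₁ X₂ ⇒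
     Closeᶠ (fourfoldᵗ μ) X₁ X₃ ⇒ Closeᶠ (fourfoldᵗ μ) X₂ X₄ ⇒ Lessᶠ (fourfoldᵗ μ) X₃ X₄)
    (λ e → NatFacts.Less-resp-Close (e (# 0)) (frac₁ e) (frac₂ e) (frac₃ e) (frac₄ e))
    (m ∷ x ∷ꟳ y ∷ꟳ x' ∷ꟳ y' ∷ꟳ [])

  ≮-Less : ∀ m a b a' b' → NonzeroDen a → NonzeroDen b → NonzeroDen a' → NonzeroDen b' →
           ¬ (scale m a <ꟳ (1ꟳ +ꟳ scale m b)) → Close (fourfold m) a a' → Close (fourfold m) b b' →
           Less (fourfold m) b' a'
  ≮-Less m a b a' b' = valid
    (NonzeroDenᶠ X₁ ⇒ NonzeroDenᶠ X₂ ⇒ NonzeroDenᶠ X₃ ⇒ NonzeroDenᶠ X₄ ⇒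
     ((scaleᵗ μ X₁ <ꟳᶠ (1ꟳᵗ +ꟳᵗ scaleᵗ μ X₂)) ⇒ ⊥f) ⇒
     Closeᶠ (fourfoldᵗ μ) X₁ X₃ ⇒ Closeᶠ (fourfoldᵗ μ) X₂ X₄ ⇒ Lessᶠ (fourfoldᵗ μ) X₄ X₃)
    (λ e → NatFacts.≮-Less (e (# 0)) (frac₁ e) (frac₂ e) (frac₃ e) (frac₄ e))
    (m ∷ a ∷ꟳ b ∷ꟳ a' ∷ꟳ b' ∷ꟳ [])

  Less-0-·ꟳ : ∀ m₁ m₂ x y → NonzeroDen x → NonzeroDen y → Less m₁ 0ꟳ x → Less m₂ 0ꟳ y →
              Less (m₁ · m₂) 0ꟳ (x ·ꟳ y)
  Less-0-·ꟳ m₁ m₂ x y = valid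
    (NonzeroDenᶠ X₁ ⇒ NonzeroDenᶠ X₂ ⇒ Lessᶠ μ 0ꟳᵗ X₁ ⇒ Lessᶠ (var (# 7)) 0ꟳᵗ X₂ ⇒
     Lessᶠ (μ ⊗ var (# 7)) 0ꟳᵗ (X₁ ·ꟳᵗ X₂))
    (λ e → NatFacts.Less-0-·ꟳ (e (# 0)) (e (# 7)) (frac₁ e) (frac₂ e)) (m₁ ∷ x ∷ꟳ y ∷ꟳ m₂ ∷ [])

  ¬Close-0⇒Apart : ∀ m a b → NonzeroDen a → NonzeroDen b → ¬ Close m a 0ꟳ → Close (m + m) b a → Apart (m + m) b
  ¬Close-0⇒Apart m a b = valid
    (NonzeroDenᶠ X₁ ⇒ NonzeroDenᶠ X₂ ⇒ (Closeᶠ μ X₁ 0ꟳᵗ ⇒ ⊥f) ⇒ Closeᶠ (μ ⊕ μ) X₂ X₁ ⇒ Apartᶠ (μ ⊕ μ) X₂)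
    (λ e → NatFacts.¬Close-0⇒Apart (e (# 0)) (frac₁ e) (frac₂ e)) (m ∷ a ∷ꟳ b ∷ꟳ [])

  NonzeroDen-inverse : ∀ a r → NonzeroDen a → IsInverse a r → NonzeroDen r
  NonzeroDen-inverse a r = valid (NonzeroDenᶠ X₁ ⇒ IsInverseᶠ X₁ X₂ ⇒ NonzeroDenᶠ X₂)
    (λ e → NatFacts.NonzeroDen-inverse (frac₁ e) (frac₂ e)) (0ᴹ ∷ a ∷ꟳ r ∷ꟳ [])

  Close-inverse : ∀ m c a b r s → NonzeroDen a → NonzeroDen b → IsInverse a r → IsInverse b s →
                  Apart c a → Apart c b → Close ((c · c) · m) a b → Close m r s
  Close-inverse m c a b r s = valid
    (NonzeroDenᶠ X₁ ⇒ NonzeroDenᶠ X₂ ⇒ IsInverseᶠ X₁ X₃ ⇒ IsInverseᶠ X₂ X₄ ⇒ Apartᶠ γ X₁ ⇒ Apartᶠ γ X₂ ⇒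
     Closeᶠ ((γ ⊗ γ) ⊗ μ) X₁ X₂ ⇒ Closeᶠ μ X₃ X₄)
    (λ e → NatFacts.Close-inverse (e (# 0)) (e (# 13)) (frac₁ e) (frac₂ e) (frac₃ e) (frac₄ e))
    (m ∷ a ∷ꟳ b ∷ꟳ r ∷ꟳ s ∷ꟳ c ∷ [])
    where
    γ : Term 14
    γ = var (# 13)

  ·ꟳ-inverseʳ : ∀ m c a r → NonzeroDen a → IsInverse a r → Apart c a → Close m (a ·ꟳ r) 1ꟳ
  ·ꟳ-inverseʳ m c a r = valid
    (NonzeroDenᶠ X₁ ⇒ IsInverseᶠ X₁ X₂ ⇒ Apartᶠ (var (# 7)) X₁ ⇒ Closeᶠ μ (X₁ ·ꟳᵗ X₂) 1ꟳᵗ)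
    (λ e → NatFacts.·ꟳ-inverseʳ (e (# 0)) (e (# 7)) (frac₁ e) (frac₂ e)) (m ∷ a ∷ꟳ r ∷ꟳ c ∷ [])

  inverseBy : ∀ p q b → (p < q) ⊎ (p ≡ q) ⊎ (q < p) → Frac
  inverseBy p q b (inj₁ p<q)        = (0ᴹ , b) , proj₁ (difference p<q)
  inverseBy p q b (inj₂ (inj₁ _))   = (0ᴹ , 0ᴹ) , 1ᴹ
  inverseBy p q b (inj₂ (inj₂ q<p)) = (b , 0ᴹ) , proj₁ (difference q<p)

  inverse : Frac → Frac
  inverse ((p , q) , b) = inverseBy p q b (trichotomy p q)

  inverseBy-IsInverse : ∀ p q b t → IsInverse ((p , q) , b) (inverseBy p q b t)
  inverseBy-IsInverse p q b (inj₁ p<q)        = inj₂ (inj₂ (p<q , refl , refl , proj₂ (difference p<q)))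
  inverseBy-IsInverse p q b (inj₂ (inj₁ p≡q)) = inj₁ (p≡q , refl , refl , refl)
  inverseBy-IsInverse p q b (inj₂ (inj₂ q<p)) = inj₂ (inj₁ (q<p , refl , refl , proj₂ (difference q<p)))

  inverse-IsInverse : ∀ a → IsInverse a (inverse a)
  inverse-IsInverse ((p , q) , b) = inverseBy-IsInverse p q b (trichotomy p q)

  IsInverse⇒≡inverseBy : ∀ p q b t r → IsInverse ((p , q) , b) r → inverseBy p q b t ≡ r
  IsInverse⇒≡inverseBy p q b (inj₁ p<q) _ (inj₁ (refl , _)) = ⊥-elim (<-irrefl p p<q)
  IsInverse⇒≡inverseBy p q b (inj₁ p<q) _ (inj₂ (inj₁ (q<p , _))) = ⊥-elim (<-asym p q p<q q<p)
  IsInverse⇒≡inverseBy p q b (inj₁ p<q) _ (inj₂ (inj₂ (_ , refl , refl , p+d≡q))) =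
    cong (_ ,_) (+-cancelˡ p _ _ (trans (proj₂ (difference p<q)) (sym p+d≡q)))
  IsInverse⇒≡inverseBy p q b (inj₂ (inj₁ _)) _ (inj₁ (_ , refl , refl , refl)) = refl
  IsInverse⇒≡inverseBy p q b (inj₂ (inj₁ refl)) _ (inj₂ (inj₁ (p<p , _))) = ⊥-elim (<-irrefl p p<p)
  IsInverse⇒≡inverseBy p q b (inj₂ (inj₁ refl)) _ (inj₂ (inj₂ (p<p , _))) = ⊥-elim (<-irrefl p p<p)
  IsInverse⇒≡inverseBy p q b (inj₂ (inj₂ q<p)) _ (inj₁ (refl , _)) = ⊥-elim (<-irrefl p q<p)
  IsInverse⇒≡inverseBy p q b (inj₂ (inj₂ q<p)) _ (inj₂ (inj₁ (_ , refl , refl , q+d≡p))) =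
    cong (_ ,_) (+-cancelˡ q _ _ (trans (proj₂ (difference q<p)) (sym q+d≡p)))
  IsInverse⇒≡inverseBy p q b (inj₂ (inj₂ q<p)) _ (inj₂ (inj₂ (p<q , _))) = ⊥-elim (<-asym p q p<q q<p)

  IsInverse⇒≡inverse : ∀ a r → IsInverse a r → inverse a ≡ r
  IsInverse⇒≡inverse ((p , q) , b) = IsInverse⇒≡inverseBy p q b (trichotomy p q)

module Definability (M : Structure) (M⊨Th : ModelOfThN M) where
  open Structure M using (Carrier)
  open KM M
  open FracOps M
  open InModel M M⊨Th

  Sat-≐ꟳ : ∀ {n} (X Y : FracTerm n) (e : Vector Carrier n) → Sat M (X ≐ꟳ Y) e ⇔ evalꟳ M X e ≡ evalꟳ M Y e
  Sat-≐ꟳ X Y e = mk⇔ (λ (p≡ , q≡ , b≡) → cong₂ _,_ (cong₂ _,_ p≡ q≡) b≡)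
                      (λ x≡y → cong (proj₁ ∘ proj₁) x≡y , cong (proj₂ ∘ proj₁) x≡y , cong proj₂ x≡y)

  DefinableGraph-const : ∀ c (C : FracTerm 4) → (∀ e → evalꟳ M C e ≡ c) → DefinableGraph (λ _ → c)
  DefinableGraph-const c C C≡c = 0 , [] , (R ≐ꟳ C) , λ i p q b →
    (λ s → sym (trans (Equivalence.to (Sat-≐ꟳ R C (env i p q b)) s) (C≡c _))) ,
    (λ c≡ → Equivalence.from (Sat-≐ꟳ R C (env i p q b)) (sym (trans (C≡c _) c≡)))
    where
    R : FracTerm 4
    R = fracVar (# 1) (# 2) (# 3)
    env : Carrier → Carrier → Carrier → Carrier → Vector Carrier 4
    env i p q b = (i ∷ p ∷ q ∷ b ∷ []) ++ []

  -- The graph of f, with the argument in variables 0–2 and the value in 3–5.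
  DefinableMap₁ : (Frac → Frac) → Set
  DefinableMap₁ f = Σ (Formula 6) λ χ → ∀ x r → Sat M χ (x ∷ꟳ r ∷ꟳ []) ⇔ f x ≡ r

  DefinableMap₂ : (Frac → Frac → Frac) → Set
  DefinableMap₂ f = Σ (Formula 9) λ χ → ∀ x y r → Sat M χ (x ∷ꟳ y ∷ꟳ r ∷ꟳ []) ⇔ f x y ≡ r

  DefinableGraph-map₁ : ∀ {f x} → DefinableMap₁ f → DefinableGraph x → DefinableGraph (λ i → f (x i))
  DefinableGraph-map₁ {f} {x} (χ , hχ) (k , ps , φ , hφ) = k , ps , ψ , λ i p q b → to i p q b , from i p q b
    where
    ρ : Fin (4 ℕ.+ k) → Fin (7 ℕ.+ k)
    ρ zero                      = # 3
    ρ (suc zero)                = # 2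
    ρ (suc (suc zero))          = # 1
    ρ (suc (suc (suc zero)))    = # 0
    ρ (suc (suc (suc (suc j)))) = 7 ↑ʳ j
    σ : Fin 6 → Fin (7 ℕ.+ k)
    σ zero                             = # 2
    σ (suc zero)                       = # 1
    σ (suc (suc zero))                 = # 0
    σ (suc (suc (suc zero)))           = # 4
    σ (suc (suc (suc (suc zero))))     = # 5
    σ (suc (suc (suc (suc (suc zero))))) = # 6
    ψ : Formula (4 ℕ.+ k)
    ψ = ∃f (∃f (∃f (rename ρ φ ∧f rename σ χ)))
    E : (i p q b p₁ q₁ b₁ : Carrier) → Vector Carrier (7 ℕ.+ k)
    E i p q b p₁ q₁ b₁ = b₁ ∷ q₁ ∷ p₁ ∷ (i ∷ p ∷ q ∷ b ∷ []) ++ ps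
    atρ : ∀ i p q b p₁ q₁ b₁ j → E i p q b p₁ q₁ b₁ (ρ j) ≡ ((i ∷ p₁ ∷ q₁ ∷ b₁ ∷ []) ++ ps) j
    atρ _ _ _ _ _ _ _ zero                      = refl
    atρ _ _ _ _ _ _ _ (suc zero)                = refl
    atρ _ _ _ _ _ _ _ (suc (suc zero))          = refl
    atρ _ _ _ _ _ _ _ (suc (suc (suc zero)))    = refl
    atρ _ _ _ _ _ _ _ (suc (suc (suc (suc j)))) = refl
    atσ : ∀ i p q b p₁ q₁ b₁ j → E i p q b p₁ q₁ b₁ (σ j) ≡ (((p₁ , q₁) , b₁) ∷ꟳ ((p , q) , b) ∷ꟳ []) j
    atσ _ _ _ _ _ _ _ zero                               = refl
    atσ _ _ _ _ _ _ _ (suc zero)                         = refl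
    atσ _ _ _ _ _ _ _ (suc (suc zero))                   = refl
    atσ _ _ _ _ _ _ _ (suc (suc (suc zero)))             = refl
    atσ _ _ _ _ _ _ _ (suc (suc (suc (suc zero))))       = refl
    atσ _ _ _ _ _ _ _ (suc (suc (suc (suc (suc zero))))) = refl
    to : ∀ i p q b → Sat M ψ ((i ∷ p ∷ q ∷ b ∷ []) ++ ps) → f (x i) ≡ ((p , q) , b)
    to i p q b (p₁ , q₁ , b₁ , sφ , sχ) =
      trans (cong f (proj₁ (hφ i p₁ q₁ b₁) (Equivalence.to (Sat-rename M ρ φ (atρ i p q b p₁ q₁ b₁)) sφ)))
            (Equivalence.to (hχ _ _) (Equivalence.to (Sat-rename M σ χ (atσ i p q b p₁ q₁ b₁)) sχ))
    from : ∀ i p q b → f (x i) ≡ ((p , q) , b) → Sat M ψ ((i ∷ p ∷ q ∷ b ∷ []) ++ ps)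
    from i p q b fx≡ = p₁ , q₁ , b₁ ,
      Equivalence.from (Sat-rename M ρ φ (atρ i p q b p₁ q₁ b₁)) (proj₂ (hφ i p₁ q₁ b₁) refl) ,
      Equivalence.from (Sat-rename M σ χ (atσ i p q b p₁ q₁ b₁)) (Equivalence.from (hχ (x i) _) fx≡)
      where
      p₁ = proj₁ (proj₁ (x i))
      q₁ = proj₂ (proj₁ (x i))
      b₁ = proj₂ (x i)

  DefinableGraph-map₂ : ∀ {f x y} → DefinableMap₂ f → DefinableGraph x → DefinableGraph y →
                        DefinableGraph (λ i → f (x i) (y i))
  DefinableGraph-map₂ {f} {x} {y} (χ , hχ) (kx , px , φx , hx) (ky , py , φy , hy) =
    kx ℕ.+ ky , px ++ py , ψ , λ i p q b → to i p q b , from i p q b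
    where
    ρx : Fin (4 ℕ.+ kx) → Fin (10 ℕ.+ (kx ℕ.+ ky))
    ρx zero                      = # 6
    ρx (suc zero)                = # 5
    ρx (suc (suc zero))          = # 4
    ρx (suc (suc (suc zero)))    = # 3
    ρx (suc (suc (suc (suc j)))) = 10 ↑ʳ (j ↑ˡ ky)
    ρy : Fin (4 ℕ.+ ky) → Fin (10 ℕ.+ (kx ℕ.+ ky))
    ρy zero                      = # 6
    ρy (suc zero)                = # 2
    ρy (suc (suc zero))          = # 1
    ρy (suc (suc (suc zero)))    = # 0
    ρy (suc (suc (suc (suc j)))) = 10 ↑ʳ (kx ↑ʳ j)
    σ : Fin 9 → Fin (10 ℕ.+ (kx ℕ.+ ky))
    σ zero                                                   = # 5
    σ (suc zero)                                             = # 4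
    σ (suc (suc zero))                                       = # 3
    σ (suc (suc (suc zero)))                                 = # 2
    σ (suc (suc (suc (suc zero))))                           = # 1
    σ (suc (suc (suc (suc (suc zero)))))                     = # 0
    σ (suc (suc (suc (suc (suc (suc zero))))))               = # 7
    σ (suc (suc (suc (suc (suc (suc (suc zero)))))))         = # 8
    σ (suc (suc (suc (suc (suc (suc (suc (suc zero)))))))) = # 9
    ψ : Formula (4 ℕ.+ (kx ℕ.+ ky))
    ψ = ∃f (∃f (∃f (∃f (∃f (∃f (rename ρx φx ∧f (rename ρy φy ∧f rename σ χ)))))))
    E : (i p q b p₁ q₁ b₁ p₂ q₂ b₂ : Carrier) → Vector Carrier (10 ℕ.+ (kx ℕ.+ ky))
    E i p q b p₁ q₁ b₁ p₂ q₂ b₂ = b₂ ∷ q₂ ∷ p₂ ∷ b₁ ∷ q₁ ∷ p₁ ∷ (i ∷ p ∷ q ∷ b ∷ []) ++ (px ++ py)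
    atρx : ∀ i p q b p₁ q₁ b₁ p₂ q₂ b₂ j → E i p q b p₁ q₁ b₁ p₂ q₂ b₂ (ρx j) ≡ ((i ∷ p₁ ∷ q₁ ∷ b₁ ∷ []) ++ px) j
    atρx _ _ _ _ _ _ _ _ _ _ zero                      = refl
    atρx _ _ _ _ _ _ _ _ _ _ (suc zero)                = refl
    atρx _ _ _ _ _ _ _ _ _ _ (suc (suc zero))          = refl
    atρx _ _ _ _ _ _ _ _ _ _ (suc (suc (suc zero)))    = refl
    atρx _ _ _ _ _ _ _ _ _ _ (suc (suc (suc (suc j)))) rewrite splitAt-↑ˡ kx j ky = refl
    atρy : ∀ i p q b p₁ q₁ b₁ p₂ q₂ b₂ j → E i p q b p₁ q₁ b₁ p₂ q₂ b₂ (ρy j) ≡ ((i ∷ p₂ ∷ q₂ ∷ b₂ ∷ []) ++ py) j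
    atρy _ _ _ _ _ _ _ _ _ _ zero                      = refl
    atρy _ _ _ _ _ _ _ _ _ _ (suc zero)                = refl
    atρy _ _ _ _ _ _ _ _ _ _ (suc (suc zero))          = refl
    atρy _ _ _ _ _ _ _ _ _ _ (suc (suc (suc zero)))    = refl
    atρy _ _ _ _ _ _ _ _ _ _ (suc (suc (suc (suc j)))) rewrite splitAt-↑ʳ kx ky j = refl
    atσ : ∀ i p q b p₁ q₁ b₁ p₂ q₂ b₂ j →
          E i p q b p₁ q₁ b₁ p₂ q₂ b₂ (σ j) ≡ (((p₁ , q₁) , b₁) ∷ꟳ ((p₂ , q₂) , b₂) ∷ꟳ ((p , q) , b) ∷ꟳ []) j
    atσ _ _ _ _ _ _ _ _ _ _ zero                                                   = refl
    atσ _ _ _ _ _ _ _ _ _ _ (suc zero)                                             = refl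
    atσ _ _ _ _ _ _ _ _ _ _ (suc (suc zero))                                       = refl
    atσ _ _ _ _ _ _ _ _ _ _ (suc (suc (suc zero)))                                 = refl
    atσ _ _ _ _ _ _ _ _ _ _ (suc (suc (suc (suc zero))))                           = refl
    atσ _ _ _ _ _ _ _ _ _ _ (suc (suc (suc (suc (suc zero)))))                     = refl
    atσ _ _ _ _ _ _ _ _ _ _ (suc (suc (suc (suc (suc (suc zero))))))               = refl
    atσ _ _ _ _ _ _ _ _ _ _ (suc (suc (suc (suc (suc (suc (suc zero)))))))         = refl
    atσ _ _ _ _ _ _ _ _ _ _ (suc (suc (suc (suc (suc (suc (suc (suc zero)))))))) = refl
    to : ∀ i p q b → Sat M ψ ((i ∷ p ∷ q ∷ b ∷ []) ++ (px ++ py)) → f (x i) (y i) ≡ ((p , q) , b)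
    to i p q b (p₁ , q₁ , b₁ , p₂ , q₂ , b₂ , sx , sy , sχ) =
      trans (cong₂ f (proj₁ (hx i p₁ q₁ b₁) (Equivalence.to (Sat-rename M ρx φx (atρx i p q b p₁ q₁ b₁ p₂ q₂ b₂)) sx))
                     (proj₁ (hy i p₂ q₂ b₂) (Equivalence.to (Sat-rename M ρy φy (atρy i p q b p₁ q₁ b₁ p₂ q₂ b₂)) sy)))
            (Equivalence.to (hχ _ _ _) (Equivalence.to (Sat-rename M σ χ (atσ i p q b p₁ q₁ b₁ p₂ q₂ b₂)) sχ))
    from : ∀ i p q b → f (x i) (y i) ≡ ((p , q) , b) → Sat M ψ ((i ∷ p ∷ q ∷ b ∷ []) ++ (px ++ py))
    from i p q b fxy≡ = p₁ , q₁ , b₁ , p₂ , q₂ , b₂ ,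
      Equivalence.from (Sat-rename M ρx φx (atρx i p q b p₁ q₁ b₁ p₂ q₂ b₂)) (proj₂ (hx i p₁ q₁ b₁) refl) ,
      Equivalence.from (Sat-rename M ρy φy (atρy i p q b p₁ q₁ b₁ p₂ q₂ b₂)) (proj₂ (hy i p₂ q₂ b₂) refl) ,
      Equivalence.from (Sat-rename M σ χ (atσ i p q b p₁ q₁ b₁ p₂ q₂ b₂)) (Equivalence.from (hχ (x i) (y i) _) fxy≡)
      where
      p₁ = proj₁ (proj₁ (x i))
      q₁ = proj₂ (proj₁ (x i))
      b₁ = proj₂ (x i)
      p₂ = proj₁ (proj₁ (y i))
      q₂ = proj₂ (proj₁ (y i))
      b₂ = proj₂ (y i)

  neg-definable : DefinableMap₁ neg
  neg-definable = (R ≐ꟳ negᵗ X) , λ x r →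
    mk⇔ (λ s → sym (Equivalence.to (Sat-≐ꟳ R (negᵗ X) (x ∷ꟳ r ∷ꟳ [])) s))
        (λ eq → Equivalence.from (Sat-≐ꟳ R (negᵗ X) (x ∷ꟳ r ∷ꟳ [])) (sym eq))
    where
    X R : FracTerm 6
    X = fracVar (# 0) (# 1) (# 2)
    R = fracVar (# 3) (# 4) (# 5)

  inverse-definable : DefinableMap₁ inverse
  inverse-definable = IsInverseᶠ (fracVar (# 0) (# 1) (# 2)) (fracVar (# 3) (# 4) (# 5)) , λ x r →
    mk⇔ (IsInverse⇒≡inverse x r) (λ { refl → inverse-IsInverse x })

  op₂-definable : ∀ {f} (F : FracTerm 9 → FracTerm 9 → FracTerm 9) →
                  (∀ X Y e → evalꟳ M (F X Y) e ≡ f (evalꟳ M X e) (evalꟳ M Y e)) → DefinableMap₂ f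
  op₂-definable {f} F F≡f = (Z ≐ꟳ F X Y) , λ x y r →
    mk⇔ (λ s → sym (trans (Equivalence.to (Sat-≐ꟳ Z (F X Y) (x ∷ꟳ y ∷ꟳ r ∷ꟳ [])) s) (F≡f X Y _)))
        (λ eq → Equivalence.from (Sat-≐ꟳ Z (F X Y) (x ∷ꟳ y ∷ꟳ r ∷ꟳ [])) (sym (trans (F≡f X Y _) eq)))
    where
    X Y Z : FracTerm 9
    X = fracVar (# 0) (# 1) (# 2)
    Y = fracVar (# 3) (# 4) (# 5)
    Z = fracVar (# 6) (# 7) (# 8)

  +ꟳ-definable : DefinableMap₂ _+ꟳ_
  +ꟳ-definable = op₂-definable _+ꟳᵗ_ λ _ _ _ → refl

  ·ꟳ-definable : DefinableMap₂ _·ꟳ_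
  ·ꟳ-definable = op₂-definable _·ꟳᵗ_ λ _ _ _ → refl

module Classical (lem : ExcludedMiddle 0ℓ) where
  ¬¬-elim : ∀ {P : Set} → ¬ ¬ P → P
  ¬¬-elim = em⇒dne lem

  ¬Π⇒Σ¬ : ∀ {A : Set} {P : A → Set} → ¬ (∀ a → P a) → Σ A λ a → ¬ P a
  ¬Π⇒Σ¬ ¬∀ = ¬¬-elim λ ¬∃ → ¬∀ λ a → ¬¬-elim λ ¬Pa → ¬∃ (a , ¬Pa)

  ¬→⇒×¬ : ∀ {A B : Set} → ¬ (A → B) → A × ¬ B
  ¬→⇒×¬ ¬A→B = ¬¬-elim (λ ¬A → ¬A→B (λ a → ⊥-elim (¬A a))) , λ b → ¬A→B (λ _ → b)

module Construction (lem : ExcludedMiddle 0ℓ) (M : Structure) (M⊨Th : ModelOfThN M) where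
  open Structure M using (Carrier; _+_; _·_; _<_) renaming (zero to 0ᴹ; one to 1ᴹ)
  open KM M
  open FracOps M
  open InModel M M⊨Th
  open Definability M M⊨Th
  open Classical lem
  open IsMReal

  Eventually : (Carrier → Set) → Set
  Eventually P = Σ Carrier λ n → ∀ k → n < k → P k

  Eventually-zip : ∀ {P Q R : Carrier → Set} → (∀ {k} → P k → Q k → R k) →
                   Eventually P → Eventually Q → Eventually R
  Eventually-zip f (n₁ , h₁) (n₂ , h₂) = n₁ + n₂ , λ k n<k → f (h₁ k (+-<ˡ n<k)) (h₂ k (+-<ʳ n<k))

  Eventually₂ : (Carrier → Carrier → Set) → Set
  Eventually₂ P = Σ Carrier λ n → ∀ k₁ k₂ → n < k₁ → n < k₂ → P k₁ k₂

  Eventually₂-zip : ∀ {P Q R : Carrier → Carrier → Set} → (∀ {k₁ k₂} → P k₁ k₂ → Q k₁ k₂ → R k₁ k₂) →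
                    Eventually₂ P → Eventually₂ Q → Eventually₂ R
  Eventually₂-zip f (n₁ , h₁) (n₂ , h₂) =
    n₁ + n₂ , λ k₁ k₂ n<k₁ n<k₂ → f (h₁ k₁ k₂ (+-<ˡ n<k₁) (+-<ˡ n<k₂)) (h₂ k₁ k₂ (+-<ʳ n<k₁) (+-<ʳ n<k₂))

  Eventually-at : ∀ {P} → ((n , _) : Eventually P) → P (n + 1ᴹ)
  Eventually-at (n , h) = h (n + 1ᴹ) (n<n+1 n)

  termwise-≈ : ∀ {x y} → (∀ m k → Close m (x k) (y k)) → x ≈ y
  termwise-≈ h m _ = 0ᴹ , λ k _ → h m k

  IsMReal-const : ∀ c (C : FracTerm 4) → (∀ e → evalꟳ M C e ≡ c) → NonzeroDen c → IsMReal (λ _ → c)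
  IsMReal-const c C C≡c c≠0 = record
    { den≢0      = λ _ → c≠0
    ; definable  = DefinableGraph-const c C C≡c
    ; convergent = λ m _ → 0ᴹ , λ _ _ _ _ → Close-refl m c c≠0
    }

  IsMReal-⊞ : ∀ {x y} → IsMReal x → IsMReal y → IsMReal (x ⊞ y)
  IsMReal-⊞ {x} {y} X Y = record
    { den≢0      = λ i → *-≢0 (den (x i)) (den (y i)) (den≢0 X i) (den≢0 Y i)
    ; definable  = DefinableGraph-map₂ +ꟳ-definable (definable X) (definable Y)
    ; convergent = λ m 0<m →
        Eventually₂-zip (λ {k₁} {k₂} → Close-+ꟳ m (x k₁) (x k₂) (y k₁) (y k₂)
                                          (den≢0 X k₁) (den≢0 X k₂) (den≢0 Y k₁) (den≢0 Y k₂))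
          (convergent X (m + m) (double-pos m 0<m)) (convergent Y (m + m) (double-pos m 0<m))
    }

  -- |x_k| and |y'_k'| are eventually bounded by the heights of fixed terms x₀, y₀ of the sequences.
  product-estimate : ∀ {x y'} → IsMReal x → IsMReal y' → ∀ m → 0ᴹ < m →
    Σ Carrier λ K → 0ᴹ < K × Eventually₂ λ k k' → ∀ x' y → NonzeroDen x' → NonzeroDen y →
      Close K (x k) x' → Close K y (y' k') → Close m (x k ·ꟳ y) (x' ·ꟳ y' k')
  product-estimate {x} {y'} X Y' m 0<m =
    productModulus m x₀ y₀ , productModulus-pos m x₀ y₀ 0<m ,
    Eventually₂-zip (λ {k} {k'} x≈x₀ y'≈y₀ x' y x'≠0 y≠0 →
                       Close-·ꟳ m (x k) x' y (y' k') x₀ y₀ (den≢0 X k) x'≠0 y≠0 (den≢0 Y' k')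
                         (den≢0 X _) (den≢0 Y' _) x≈x₀ y'≈y₀)
      (proj₁ cx , λ k _ n<k _ → proj₂ cx k (proj₁ cx + 1ᴹ) n<k (n<n+1 _))
      (proj₁ cy , λ _ k' _ n<k' → proj₂ cy k' (proj₁ cy + 1ᴹ) n<k' (n<n+1 _))
    where
    cx = convergent X 1ᴹ 0<1
    cy = convergent Y' 1ᴹ 0<1
    x₀ = x (proj₁ cx + 1ᴹ)
    y₀ = y' (proj₁ cy + 1ᴹ)

  IsMReal-⊠ : ∀ {x y} → IsMReal x → IsMReal y → IsMReal (x ⊠ y)
  IsMReal-⊠ {x} {y} X Y = record
    { den≢0      = λ i → *-≢0 (den (x i)) (den (y i)) (den≢0 X i) (den≢0 Y i)
    ; definable  = DefinableGraph-map₂ ·ꟳ-definable (definable X) (definable Y)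
    ; convergent = λ m 0<m →
        let (K , 0<K , estimate) = product-estimate X Y m 0<m in
        Eventually₂-zip (λ {k₁} {k₂} est (x≈ , y≈) → est (x k₂) (y k₁) (den≢0 X k₂) (den≢0 Y k₁) x≈ y≈)
          estimate (Eventually₂-zip _,_ (convergent X K 0<K) (convergent Y K 0<K))
    }

  IsMReal-neg : ∀ {x} → IsMReal x → IsMReal (λ i → neg (x i))
  IsMReal-neg {x} X = record
    { den≢0      = den≢0 X
    ; definable  = DefinableGraph-map₁ neg-definable (definable X)
    ; convergent = λ m 0<m → let (n , h) = convergent X m 0<m in
        n , λ k₁ k₂ n<k₁ n<k₂ → Close-neg m (x k₁) (x k₂) (den≢0 X k₁) (den≢0 X k₂) (h k₁ k₂ n<k₁ n<k₂)
    }

  ≈-refl : ∀ {x} → IsMReal x → x ≈ x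
  ≈-refl {x} X = termwise-≈ λ m k → Close-refl m (x k) (den≢0 X k)

  ≈-sym : ∀ {x y} → x ≈ y → y ≈ x
  ≈-sym x≈y m 0<m = let (n , h) = x≈y m 0<m in n , λ k n<k → let (h₁ , h₂) = h k n<k in h₂ , h₁

  ≈-trans : ∀ {x y z} → IsMReal x → IsMReal y → IsMReal z → x ≈ y → y ≈ z → x ≈ z
  ≈-trans {x} {y} {z} X Y Z x≈y y≈z m 0<m =
    Eventually-zip (λ {k} → Close-trans m (x k) (y k) (z k) (den≢0 X k) (den≢0 Y k) (den≢0 Z k))
      (x≈y (m + m) (double-pos m 0<m)) (y≈z (m + m) (double-pos m 0<m))

  ⊞-cong : ∀ {x x' y y'} → IsMReal x → IsMReal x' → IsMReal y → IsMReal y' →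
           x ≈ x' → y ≈ y' → (x ⊞ y) ≈ (x' ⊞ y')
  ⊞-cong {x} {x'} {y} {y'} X X' Y Y' x≈x' y≈y' m 0<m =
    Eventually-zip (λ {k} → Close-+ꟳ m (x k) (x' k) (y k) (y' k) (den≢0 X k) (den≢0 X' k) (den≢0 Y k) (den≢0 Y' k))
      (x≈x' (m + m) (double-pos m 0<m)) (y≈y' (m + m) (double-pos m 0<m))

  ⊠-cong : ∀ {x x' y y'} → IsMReal x → IsMReal x' → IsMReal y → IsMReal y' →
           x ≈ x' → y ≈ y' → (x ⊠ y) ≈ (x' ⊠ y')
  ⊠-cong {x} {x'} {y} {y'} X X' Y Y' x≈x' y≈y' m 0<m =
    let (K , 0<K , (n , estimate)) = product-estimate X Y' m 0<m in
    Eventually-zip (λ {k} est (x≈ , y≈) → est (x' k) (y k) (den≢0 X' k) (den≢0 Y k) x≈ y≈)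
      (n , λ k n<k → estimate k k n<k n<k) (Eventually-zip _,_ (x≈x' K 0<K) (y≈y' K 0<K))

  ≺ˢ-resp-≈ : ∀ {x x' y y'} → IsMReal x → IsMReal x' → IsMReal y → IsMReal y' →
              x ≈ x' → y ≈ y' → x ≺ˢ y → x' ≺ˢ y'
  ≺ˢ-resp-≈ {x} {x'} {y} {y'} X X' Y Y' x≈x' y≈y' (m , n , 0<m , x<y) =
    let (n' , h) = Eventually-zip (λ {k} x<y' (x≈ , y≈) →
                     Less-resp-Close m (x k) (y k) (x' k) (y' k) (den≢0 X k) (den≢0 Y k) (den≢0 X' k) (den≢0 Y' k)
                       x<y' x≈ y≈)
                     (n , x<y) (Eventually-zip _,_ (x≈x' (fourfold m) 4m>0) (y≈y' (fourfold m) 4m>0))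
    in fourfold m , n' , 4m>0 , h
    where
    4m>0 = fourfold-pos m 0<m

  ¬≈⇒frequently-far : ∀ {x y} → ¬ x ≈ y →
                      Σ Carrier λ m → 0ᴹ < m × ∀ n → Σ Carrier λ k → n < k × ¬ Close m (x k) (y k)
  ¬≈⇒frequently-far x≉y =
    let (m , ¬close) = ¬Π⇒Σ¬ x≉y
        (0<m , ¬eventually) = ¬→⇒×¬ ¬close
    in m , 0<m , λ n → let (k , ¬close-at-k) = ¬Π⇒Σ¬ (λ h → ¬eventually (n , h)) in k , ¬→⇒×¬ ¬close-at-k

  -- A term of x far from 0, together with the convergence of x, keeps all later terms away from 0.
  eventually-apart : ∀ {x} → IsMReal x → ¬ x ≈ 0ˢ → Σ Carrier λ c → 0ᴹ < c × Eventually λ l → Apart c (x l)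
  eventually-apart {x} X x≉0 =
    let (m , 0<m , frequently) = ¬≈⇒frequently-far x≉0
        (n , cauchy) = convergent X (m + m) (double-pos m 0<m)
        (k , n<k , far) = frequently n
    in m + m , double-pos m 0<m , n , λ l n<l →
         ¬Close-0⇒Apart m (x k) (x l) (den≢0 X k) (den≢0 X l) far (cauchy l k n<l n<k)

  IsMReal-inverse : ∀ {x} → IsMReal x → ∀ c → 0ᴹ < c → Eventually (λ l → Apart c (x l)) →
                    IsMReal (λ i → inverse (x i))
  IsMReal-inverse {x} X c 0<c (n , apart) = record
    { den≢0      = λ i → NonzeroDen-inverse (x i) (inverse (x i)) (den≢0 X i) (inverse-IsInverse (x i))
    ; definable  = DefinableGraph-map₁ inverse-definable (definable X)
    ; convergent = λ m 0<m →
        Eventually₂-zip (λ {k₁} {k₂} (x₁#0 , x₂#0) →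
                           Close-inverse m c (x k₁) (x k₂) (inverse (x k₁)) (inverse (x k₂)) (den≢0 X k₁) (den≢0 X k₂)
                             (inverse-IsInverse (x k₁)) (inverse-IsInverse (x k₂)) x₁#0 x₂#0)
          (n , λ k₁ k₂ n<k₁ n<k₂ → apart k₁ n<k₁ , apart k₂ n<k₂)
          (convergent X ((c · c) · m) (*-pos (c · c) m (*-pos c c 0<c 0<c) 0<m))
    }

  ⊠-inverseʳ : ∀ {x} → IsMReal x → ∀ c → Eventually (λ l → Apart c (x l)) → (x ⊠ λ i → inverse (x i)) ≈ 1ˢ
  ⊠-inverseʳ {x} X c (n , apart) m _ =
    n , λ k n<k → ·ꟳ-inverseʳ m c (x k) (inverse (x k)) (den≢0 X k) (inverse-IsInverse (x k)) (apart k n<k)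

  ⊠-inverse : ∀ {x} → IsMReal x → ¬ x ≈ 0ˢ → Σ Seq λ y → IsMReal y × (x ⊠ y) ≈ 1ˢ
  ⊠-inverse {x} X x≉0 =
    let (c , 0<c , apart) = eventually-apart X x≉0
    in (λ i → inverse (x i)) , IsMReal-inverse X c 0<c apart , ⊠-inverseʳ X c apart

  0≉1 : ¬ 0ˢ ≈ 1ˢ
  0≉1 0≈1 = ¬Close-0ꟳ-1ꟳ (Eventually-at (0≈1 1ᴹ 0<1))

  ≺ˢ-irrefl : ∀ {x} → IsMReal x → ¬ x ≺ˢ x
  ≺ˢ-irrefl {x} X (m , n , _ , x<x) = Less-irrefl m (x (n + 1ᴹ)) (den≢0 X _) (Eventually-at (n , x<x))

  ≺ˢ-trans : ∀ {x y z} → IsMReal x → IsMReal y → IsMReal z → x ≺ˢ y → y ≺ˢ z → x ≺ˢ z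
  ≺ˢ-trans {x} {y} {z} X Y Z (m₁ , n₁ , 0<m₁ , x<y) (m₂ , n₂ , _ , y<z) =
    let (n , x<z) = Eventually-zip (λ {k} → Less-trans m₁ m₂ (x k) (y k) (z k) (den≢0 X k) (den≢0 Y k) (den≢0 Z k))
                                   (n₁ , x<y) (n₂ , y<z)
    in m₁ , n , 0<m₁ , x<z

  ⊞-monoˡ-≺ˢ : ∀ {x y z} → IsMReal x → IsMReal y → IsMReal z → x ≺ˢ y → (x ⊞ z) ≺ˢ (y ⊞ z)
  ⊞-monoˡ-≺ˢ {x} {y} {z} X Y Z (m , n , 0<m , x<y) =
    m , n , 0<m , λ k n<k → Less-+ꟳʳ m (x k) (y k) (z k) (den≢0 X k) (den≢0 Y k) (den≢0 Z k) (x<y k n<k)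

  ⊠-pos : ∀ {x y} → IsMReal x → IsMReal y → 0ˢ ≺ˢ x → 0ˢ ≺ˢ y → 0ˢ ≺ˢ (x ⊠ y)
  ⊠-pos {x} {y} X Y (m₁ , n₁ , 0<m₁ , 0<x) (m₂ , n₂ , 0<m₂ , 0<y) =
    let (n , 0<xy) = Eventually-zip (λ {k} → Less-0-·ꟳ m₁ m₂ (x k) (y k) (den≢0 X k) (den≢0 Y k))
                                    (n₁ , 0<x) (n₂ , 0<y)
    in m₁ · m₂ , n , *-pos m₁ m₂ 0<m₁ 0<m₂ , 0<xy

  -- Beyond n both sequences vary by less than 1/(4m) while x_k, y_k are 1/m apart; the sign of that gap persists.
  gap-persists : ∀ {x y} → IsMReal x → IsMReal y → ∀ m → 0ᴹ < m → ∀ n k → ¬ Close m (x k) (y k) →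
                 (∀ l → n < l → Close (fourfold m) (x k) (x l) × Close (fourfold m) (y k) (y l)) →
                 Dec (scale m (x k) <ꟳ (1ꟳ +ꟳ scale m (y k))) → x ≺ˢ y ⊎ y ≺ˢ x
  gap-persists {x} {y} X Y m 0<m n k far cauchy (yes mx<1+my) =
    inj₁ (fourfold m , n , fourfold-pos m 0<m , λ l n<l →
      ≮-Less m (y k) (x k) (y l) (x l) (den≢0 Y k) (den≢0 X k) (den≢0 Y l) (den≢0 X l)
        (λ my<1+mx → far (mx<1+my , my<1+mx)) (proj₂ (cauchy l n<l)) (proj₁ (cauchy l n<l)))
  gap-persists {x} {y} X Y m 0<m n k far cauchy (no mx≮1+my) =
    inj₂ (fourfold m , n , fourfold-pos m 0<m , λ l n<l →
      ≮-Less m (x k) (y k) (x l) (y l) (den≢0 X k) (den≢0 Y k) (den≢0 X l) (den≢0 Y l)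
        mx≮1+my (proj₁ (cauchy l n<l)) (proj₂ (cauchy l n<l)))

  ¬≈⇒separated : ∀ {x y} → IsMReal x → IsMReal y → ¬ x ≈ y → x ≺ˢ y ⊎ y ≺ˢ x
  ¬≈⇒separated {x} {y} X Y x≉y =
    let (m , 0<m , frequently) = ¬≈⇒frequently-far x≉y
        0<4m = fourfold-pos m 0<m
        (n , cauchy) = Eventually₂-zip _,_ (convergent X (fourfold m) 0<4m) (convergent Y (fourfold m) 0<4m)
        (k , n<k , far) = frequently n
    in gap-persists X Y m 0<m n k far (λ l n<l → cauchy k l n<k n<l)
         (lem {scale m (x k) <ꟳ (1ꟳ +ꟳ scale m (y k))})

  ≺ˢ-trichotomy : ∀ {x y} → IsMReal x → IsMReal y → x ≺ˢ y ⊎ x ≈ y ⊎ y ≺ˢ x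
  ≺ˢ-trichotomy {x} {y} X Y = by-cases (lem {x ≈ y})
    where
    by-cases : Dec (x ≈ y) → x ≺ˢ y ⊎ x ≈ y ⊎ y ≺ˢ x
    by-cases (yes x≈y) = inj₂ (inj₁ x≈y)
    by-cases (no x≉y)  = [ inj₁ , (λ y<x → inj₂ (inj₂ y<x)) ]′ (¬≈⇒separated X Y x≉y)

  ⊞-assoc : ∀ {x y z} → IsMReal x → IsMReal y → IsMReal z → ((x ⊞ y) ⊞ z) ≈ (x ⊞ (y ⊞ z))
  ⊞-assoc {x} {y} {z} X Y Z = termwise-≈ λ m k → +ꟳ-assoc m (x k) (y k) (z k) (den≢0 X k) (den≢0 Y k) (den≢0 Z k)

  ⊞-comm : ∀ {x y} → IsMReal x → IsMReal y → (x ⊞ y) ≈ (y ⊞ x)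
  ⊞-comm {x} {y} X Y = termwise-≈ λ m k → +ꟳ-comm m (x k) (y k) (den≢0 X k) (den≢0 Y k)

  ⊞-identityʳ : ∀ {x} → IsMReal x → (x ⊞ 0ˢ) ≈ x
  ⊞-identityʳ {x} X = termwise-≈ λ m k → +ꟳ-identityʳ m (x k) (den≢0 X k)

  ⊞-inverse : ∀ {x} → IsMReal x → Σ Seq λ y → IsMReal y × (x ⊞ y) ≈ 0ˢ
  ⊞-inverse {x} X = (λ i → neg (x i)) , IsMReal-neg X , termwise-≈ λ m k → +ꟳ-inverseʳ m (x k) (den≢0 X k)

  ⊠-assoc : ∀ {x y z} → IsMReal x → IsMReal y → IsMReal z → ((x ⊠ y) ⊠ z) ≈ (x ⊠ (y ⊠ z))
  ⊠-assoc {x} {y} {z} X Y Z = termwise-≈ λ m k → ·ꟳ-assoc m (x k) (y k) (z k) (den≢0 X k) (den≢0 Y k) (den≢0 Z k)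

  ⊠-comm : ∀ {x y} → IsMReal x → IsMReal y → (x ⊠ y) ≈ (y ⊠ x)
  ⊠-comm {x} {y} X Y = termwise-≈ λ m k → ·ꟳ-comm m (x k) (y k) (den≢0 X k) (den≢0 Y k)

  ⊠-identityʳ : ∀ {x} → IsMReal x → (x ⊠ 1ˢ) ≈ x
  ⊠-identityʳ {x} X = termwise-≈ λ m k → ·ꟳ-identityʳ m (x k) (den≢0 X k)

  ⊠-distribˡ-⊞ : ∀ {x y z} → IsMReal x → IsMReal y → IsMReal z → (x ⊠ (y ⊞ z)) ≈ ((x ⊠ y) ⊞ (x ⊠ z))
  ⊠-distribˡ-⊞ {x} {y} {z} X Y Z =
    termwise-≈ λ m k → ·ꟳ-distribˡ-+ꟳ m (x k) (y k) (z k) (den≢0 X k) (den≢0 Y k) (den≢0 Z k)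

mainTheorem8 : ExcludedMiddle 0ℓ →
    (M : Structure) → ModelOfThN M → KM.IsOrderedField M
mainTheorem8 lem M M⊨Th = record
  { 0-real       = IsMReal-const 0ꟳ 0ꟳᵗ (λ _ → refl) 1≢0
  ; 1-real       = IsMReal-const 1ꟳ 1ꟳᵗ (λ _ → refl) 1≢0
  ; +-real       = IsMReal-⊞
  ; ·-real       = IsMReal-⊠
  ; ≈-refl       = ≈-refl
  ; ≈-sym        = λ _ _ → ≈-sym
  ; ≈-trans      = ≈-trans
  ; +-cong       = ⊞-cong
  ; ·-cong       = ⊠-cong
  ; <-resp       = ≺ˢ-resp-≈
  ; +-assoc      = ⊞-assoc
  ; +-comm       = ⊞-comm
  ; +-idʳ        = ⊞-identityʳ
  ; +-inv        = ⊞-inverse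
  ; ·-assoc      = ⊠-assoc
  ; ·-comm       = ⊠-comm
  ; ·-idʳ        = ⊠-identityʳ
  ; ·-inv        = ⊠-inverse
  ; distrib      = ⊠-distribˡ-⊞
  ; 0≉1          = 0≉1
  ; <-irrefl     = ≺ˢ-irrefl
  ; <-trans      = ≺ˢ-trans
  ; <-trichotomy = ≺ˢ-trichotomy
  ; +-mono-<     = ⊞-monoˡ-≺ˢ
  ; ·-pos        = ⊠-pos
  }
  where
  open KM M using (0ꟳ; 1ꟳ)
  open InModel M M⊨Th using (1≢0)
  open Construction lem M M⊨Th
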